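{- $\mathsf{IOpen}(x^y)\vdash\mathsf{T_{x^y}}$.
   Context: $\mathsf{IOpen}(x^y)$ is the theory in the language $(0,S,+,\cdot,\leqslant,x^y)$ consisting of (Q1) $Sx\neq0$; (Q2) $Sx=Sy\to x=y$; (Q3) $x\neq0\to\exists y\,(x=Sy)$; (Q4) $x+0=x$; (Q5) $x+Sy=S(x+y)$; (Q6) $x\cdot0=0$; (Q7) $x\cdot Sy=x\cdot y+x$; (Q8) $x\leqslant y\leftrightarrow\exists r\,(r+x=y)$; (P1) $x^0=S(0)$; (P2) $y^{S(x)}=y^x\cdot y$; and the induction scheme $\big(\varphi(0,\bar y)\wedge\forall x(\varphi(x,\bar y)\to\varphi(S(x),\bar y))\big)\to\forall x\,\varphi(x,\bar y)$ for all quantifier-free formulas $\varphi$ of this language. $\mathsf{T_{x^y}}$ is the theory in the same language, with $1=S(0)$, $2=S(S(0))$, consisting of: (T1) $x^0=1$; (T2) $x^1=x$; (T3) $1^x=1$; (T4) $x^{y+z}=x^y\cdot x^z$; (T5) $(x\cdot y)^z=x^z\cdot y^z$; (T6) $(x^y)^z=x^{yz}$; (T7) $\forall x>1\,(y<z\leftrightarrow x^y<x^z)$; (T8) $\forall x>0\,(y<z\leftrightarrow y^x<z^x)$; (T9) $\forall k>0\,\exists d\,(2^d\leqslant k<2^{d+1})$; (T10) $\forall c>0\,\exists m\,(m^c\leqslant x<(m+1)^c)$; (T11) $\forall a>0\,\forall b>0\,\forall y>0\,\forall x\geqslant y\,\big((b+a)^x(by)^y\geqslant(by+ax)^yb^x\big)$.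 -}

module Defs where

open import Data.Nat using (ℕ; zero; suc)
open import Data.List using (List; []; _∷_; map)
open import Data.List.Relation.Unary.All using (All)
open import Data.List.Membership.Propositional using (_∈_)
open import Data.Product using (Σ; _×_)

infixl 7 _⊗_
infixl 6 _⊕_
infixr 8 _^'_
infix  4 _≐_ _≼_ _≺_
infixr 3 _∧'_
infixr 2 _∨'_
infixr 1 _⇒_ _⇔'_
infix  0 _⊢_ _⊩_

data Term : Set where
  var  : ℕ → Term
  𝟎    : Term
  𝐒    : Term → Term
  _⊕_  : Term → Term → Term
  _⊗_  : Term → Term → Term
  _^'_ : Term → Term → Term

renT : (ℕ → ℕ) → Term → Term
renT ρ (var n)  = var (ρ n)
renT ρ 𝟎        = 𝟎
renT ρ (𝐒 t)    = 𝐒 (renT ρ t)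
renT ρ (s ⊕ t)  = renT ρ s ⊕ renT ρ t
renT ρ (s ⊗ t)  = renT ρ s ⊗ renT ρ t
renT ρ (s ^' t) = renT ρ s ^' renT ρ t

subT : (ℕ → Term) → Term → Term
subT σ (var n)  = σ n
subT σ 𝟎        = 𝟎
subT σ (𝐒 t)    = 𝐒 (subT σ t)
subT σ (s ⊕ t)  = subT σ s ⊕ subT σ t
subT σ (s ⊗ t)  = subT σ s ⊗ subT σ t
subT σ (s ^' t) = subT σ s ^' subT σ t

data Formula : Set where
  _≐_   : Term → Term → Formula
  _≼_   : Term → Term → Formula
  ⊥'    : Formula
  _⇒_   : Formula → Formula → Formula
  _∧'_  : Formula → Formula → Formula
  _∨'_  : Formula → Formula → Formula
  ∀'    : Formula → Formula
  ∃'    : Formula → Formula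

¬' : Formula → Formula
¬' φ = φ ⇒ ⊥'

_⇔'_ : Formula → Formula → Formula
φ ⇔' ψ = (φ ⇒ ψ) ∧' (ψ ⇒ φ)

_≺_ : Term → Term → Formula
s ≺ t = (s ≼ t) ∧' ¬' (s ≐ t)

data QF : Formula → Set where
  qf-≐ : ∀ s t → QF (s ≐ t)
  qf-≼ : ∀ s t → QF (s ≼ t)
  qf-⊥ : QF ⊥'
  qf-⇒ : ∀ {φ ψ} → QF φ → QF ψ → QF (φ ⇒ ψ)
  qf-∧ : ∀ {φ ψ} → QF φ → QF ψ → QF (φ ∧' ψ)
  qf-∨ : ∀ {φ ψ} → QF φ → QF ψ → QF (φ ∨' ψ)

liftS : (ℕ → Term) → ℕ → Term
liftS σ zero    = var zero
liftS σ (suc n) = renT suc (σ n)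

sub : (ℕ → Term) → Formula → Formula
sub σ (s ≐ t)  = subT σ s ≐ subT σ t
sub σ (s ≼ t)  = subT σ s ≼ subT σ t
sub σ ⊥'       = ⊥'
sub σ (φ ⇒ ψ)  = sub σ φ ⇒ sub σ ψ
sub σ (φ ∧' ψ) = sub σ φ ∧' sub σ ψ
sub σ (φ ∨' ψ) = sub σ φ ∨' sub σ ψ
sub σ (∀' φ)   = ∀' (sub (liftS σ) φ)
sub σ (∃' φ)   = ∃' (sub (liftS σ) φ)

shift : Formula → Formula
shift = sub (λ n → var (suc n))

-- single substitution  φ[t / var 0]  (other free variables move down by one)
inst : Term → ℕ → Term
inst t zero    = t
inst t (suc n) = var n

_[_] : Formula → Term → Formula
φ [ t ] = sub (inst t) φ

succ0 : ℕ → Term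
succ0 zero    = 𝐒 (var zero)
succ0 (suc n) = var (suc n)

∀^ : ℕ → Formula → Formula
∀^ zero    φ = φ
∀^ (suc k) φ = ∀' (∀^ k φ)

data _⊢_ : List Formula → Formula → Set where
  ax   : ∀ {Γ φ} → φ ∈ Γ → Γ ⊢ φ
  raa  : ∀ {Γ φ} → (¬' φ ∷ Γ) ⊢ ⊥' → Γ ⊢ φ
  ⇒I   : ∀ {Γ φ ψ} → (φ ∷ Γ) ⊢ ψ → Γ ⊢ φ ⇒ ψ
  ⇒E   : ∀ {Γ φ ψ} → Γ ⊢ φ ⇒ ψ → Γ ⊢ φ → Γ ⊢ ψ
  ∧I   : ∀ {Γ φ ψ} → Γ ⊢ φ → Γ ⊢ ψ → Γ ⊢ φ ∧' ψ
  ∧E₁  : ∀ {Γ φ ψ} → Γ ⊢ φ ∧' ψ → Γ ⊢ φ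
  ∧E₂  : ∀ {Γ φ ψ} → Γ ⊢ φ ∧' ψ → Γ ⊢ ψ
  ∨I₁  : ∀ {Γ φ ψ} → Γ ⊢ φ → Γ ⊢ φ ∨' ψ
  ∨I₂  : ∀ {Γ φ ψ} → Γ ⊢ ψ → Γ ⊢ φ ∨' ψ
  ∨E   : ∀ {Γ φ ψ χ} → Γ ⊢ φ ∨' ψ → (φ ∷ Γ) ⊢ χ → (ψ ∷ Γ) ⊢ χ → Γ ⊢ χ
  ∀I   : ∀ {Γ φ} → map shift Γ ⊢ φ → Γ ⊢ ∀' φ
  ∀E   : ∀ {Γ φ} (t : Term) → Γ ⊢ ∀' φ → Γ ⊢ φ [ t ]
  ∃I   : ∀ {Γ φ} (t : Term) → Γ ⊢ φ [ t ] → Γ ⊢ ∃' φ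
  ∃E   : ∀ {Γ φ ψ} → Γ ⊢ ∃' φ → (φ ∷ map shift Γ) ⊢ shift ψ → Γ ⊢ ψ
  ≐refl  : ∀ {Γ} (t : Term) → Γ ⊢ t ≐ t
  ≐subst : ∀ {Γ φ s t} → Γ ⊢ s ≐ t → Γ ⊢ φ [ s ] → Γ ⊢ φ [ t ]

Theory : Set₁
Theory = Formula → Set

_⊩_ : Theory → Formula → Set
T ⊩ φ = Σ (List Formula) (λ Γ → All T Γ × (Γ ⊢ φ))

v0 v1 v2 v3 : Term
v0 = var 0
v1 = var 1
v2 = var 2
v3 = var 3

𝟏 𝟐 : Term
𝟏 = 𝐒 𝟎
𝟐 = 𝐒 (𝐒 𝟎)

-- induction instance for φ(x, ȳ) with x = var 0
indAx : Formula → Formula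
indAx φ = ((φ [ 𝟎 ]) ∧' ∀' (φ ⇒ sub succ0 φ)) ⇒ ∀' φ

data IOpenExp : Theory where
  Q1 : IOpenExp (∀^ 1 (¬' (𝐒 v0 ≐ 𝟎)))
  Q2 : IOpenExp (∀^ 2 ((𝐒 v0 ≐ 𝐒 v1) ⇒ (v0 ≐ v1)))
  Q3 : IOpenExp (∀^ 1 (¬' (v0 ≐ 𝟎) ⇒ ∃' (v1 ≐ 𝐒 v0)))
  Q4 : IOpenExp (∀^ 1 (v0 ⊕ 𝟎 ≐ v0))
  Q5 : IOpenExp (∀^ 2 (v0 ⊕ 𝐒 v1 ≐ 𝐒 (v0 ⊕ v1)))
  Q6 : IOpenExp (∀^ 1 (v0 ⊗ 𝟎 ≐ 𝟎))
  Q7 : IOpenExp (∀^ 2 (v0 ⊗ 𝐒 v1 ≐ v0 ⊗ v1 ⊕ v0))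
  Q8 : IOpenExp (∀^ 2 ((v0 ≼ v1) ⇔' ∃' (v0 ⊕ v1 ≐ v2)))
  P1 : IOpenExp (∀^ 1 (v0 ^' 𝟎 ≐ 𝐒 𝟎))
  P2 : IOpenExp (∀^ 2 (v1 ^' 𝐒 v0 ≐ (v1 ^' v0) ⊗ v1))
  Ind : (k : ℕ) (φ : Formula) → QF φ → IOpenExp (∀^ k (indAx φ))

data TExp : Theory where
  T1  : TExp (∀^ 1 (v0 ^' 𝟎 ≐ 𝟏))
  T2  : TExp (∀^ 1 (v0 ^' 𝟏 ≐ v0))
  T3  : TExp (∀^ 1 (𝟏 ^' v0 ≐ 𝟏))
  T4  : TExp (∀^ 3 (v0 ^' (v1 ⊕ v2) ≐ (v0 ^' v1) ⊗ (v0 ^' v2)))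
  T5  : TExp (∀^ 3 ((v0 ⊗ v1) ^' v2 ≐ (v0 ^' v2) ⊗ (v1 ^' v2)))
  T6  : TExp (∀^ 3 ((v0 ^' v1) ^' v2 ≐ v0 ^' (v1 ⊗ v2)))
  T7  : TExp (∀^ 3 ((𝟏 ≺ v0) ⇒ ((v1 ≺ v2) ⇔' (v0 ^' v1 ≺ v0 ^' v2))))
  T8  : TExp (∀^ 3 ((𝟎 ≺ v0) ⇒ ((v1 ≺ v2) ⇔' (v1 ^' v0 ≺ v2 ^' v0))))
  -- outside: k = v0; inside ∃: d = v0, k = v1
  T9  : TExp (∀^ 1 ((𝟎 ≺ v0) ⇒
                 ∃' ((𝟐 ^' v0 ≼ v1) ∧' (v1 ≺ 𝟐 ^' (v0 ⊕ 𝟏)))))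
  -- outside: c = v0, x = v1; inside ∃: m = v0, c = v1, x = v2
  T10 : TExp (∀^ 2 ((𝟎 ≺ v0) ⇒
                 ∃' ((v0 ^' v1 ≼ v2) ∧' (v2 ≺ (v0 ⊕ 𝟏) ^' v1))))
  -- a = v0, b = v1, y = v2, x = v3
  T11 : TExp (∀^ 4 ((𝟎 ≺ v0) ⇒ (𝟎 ≺ v1) ⇒ (𝟎 ≺ v2) ⇒ (v2 ≼ v3) ⇒
                 ((v1 ⊗ v2 ⊕ v0 ⊗ v3) ^' v2 ⊗ (v1 ^' v3)
                    ≼ (v1 ⊕ v0) ^' v3 ⊗ ((v1 ⊗ v2) ^' v2))))

-- Open induction on one argument yields the commutative semiring laws and a
-- discrete linear order for which + and · are monotone; induction on the
-- exponent then yields T1–T8.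
-- T9 and T10 are proved by contradiction: if no d (resp. m) brackets k (resp. x),
-- induction shows 2^d ≤ k for every d (resp. m^c ≤ x for every m), which fails
-- at d = k (resp. m = x + 1). T11 follows by induction on x − y from the
-- Bernoulli-type inequality (c + a)^y c ≤ c^(y+1) + a y (c + a)^y.

module Submission where

open import Defs hiding (ax; raa; ⇒I; ⇒E; ∧I; ∧E₁; ∧E₂; ∨I₁; ∨I₂; ∨E; ∀I; ∀E; ∃I; ∃E; ≐refl; ≐subst)
open import Data.Nat using (ℕ; zero; suc)
open import Data.List using (List; []; _∷_; _++_; map)
open import Data.List.Properties using (map-++)
open import Data.List.Relation.Unary.All as All using (All; []; _∷_)
open import Data.List.Relation.Unary.All.Properties using (++⁺)
open import Data.List.Relation.Unary.Any using (here; there)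
open import Data.List.Membership.Propositional using (_∈_)
open import Data.List.Membership.Propositional.Properties using (∈-map⁺; ∈-++⁺ˡ; ∈-++⁺ʳ)
open import Data.List.Relation.Binary.Subset.Propositional using (_⊆_)
open import Data.List.Relation.Binary.Subset.Propositional.Properties
  using (∷⁺ʳ; map⁺; xs⊆xs++ys; xs⊆ys++xs; ++⁺ʳ; ++⁺ˡ)
open import Data.Product using (Σ; _×_; _,_; proj₁)
open import Data.Vec using (Vec; []; _∷_)
open import Function using (_∘_)
open import Relation.Binary.PropositionalEquality hiding ([_])

private
  variable
    Γ Δ : List Formula
    φ ψ χ ω : Formula
    s t u s₁ t₁ : Term
    σ τ : ℕ → Term

infixr 5 _∙_
_∙_ : Term → (ℕ → Term) → ℕ → Term
(t ∙ σ) zero    = t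
(t ∙ σ) (suc n) = σ n

fromVec : ∀ {k} → Vec Term k → ℕ → Term
fromVec []       = var
fromVec (t ∷ ts) = t ∙ fromVec ts

shiftT : Term → Term
shiftT = subT (var ∘ suc)

subT-cong : σ ≗ τ → ∀ t → subT σ t ≡ subT τ t
subT-cong e (var n)  = e n
subT-cong e 𝟎        = refl
subT-cong e (𝐒 t)    = cong 𝐒 (subT-cong e t)
subT-cong e (s ⊕ t)  = cong₂ _⊕_ (subT-cong e s) (subT-cong e t)
subT-cong e (s ⊗ t)  = cong₂ _⊗_ (subT-cong e s) (subT-cong e t)
subT-cong e (s ^' t) = cong₂ _^'_ (subT-cong e s) (subT-cong e t)

liftS-cong : σ ≗ τ → liftS σ ≗ liftS τ
liftS-cong e zero    = refl
liftS-cong e (suc n) = cong (renT suc) (e n)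

sub-cong : σ ≗ τ → ∀ φ → sub σ φ ≡ sub τ φ
sub-cong e (s ≐ t)  = cong₂ _≐_ (subT-cong e s) (subT-cong e t)
sub-cong e (s ≼ t)  = cong₂ _≼_ (subT-cong e s) (subT-cong e t)
sub-cong e ⊥'       = refl
sub-cong e (φ ⇒ ψ)  = cong₂ _⇒_ (sub-cong e φ) (sub-cong e ψ)
sub-cong e (φ ∧' ψ) = cong₂ _∧'_ (sub-cong e φ) (sub-cong e ψ)
sub-cong e (φ ∨' ψ) = cong₂ _∨'_ (sub-cong e φ) (sub-cong e ψ)
sub-cong e (∀' φ)   = cong ∀' (sub-cong (liftS-cong e) φ)
sub-cong e (∃' φ)   = cong ∃' (sub-cong (liftS-cong e) φ)

subT-var : ∀ t → subT var t ≡ t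
subT-var (var n)  = refl
subT-var 𝟎        = refl
subT-var (𝐒 t)    = cong 𝐒 (subT-var t)
subT-var (s ⊕ t)  = cong₂ _⊕_ (subT-var s) (subT-var t)
subT-var (s ⊗ t)  = cong₂ _⊗_ (subT-var s) (subT-var t)
subT-var (s ^' t) = cong₂ _^'_ (subT-var s) (subT-var t)

subT-subT : ∀ σ τ t → subT σ (subT τ t) ≡ subT (subT σ ∘ τ) t
subT-subT σ τ (var n)  = refl
subT-subT σ τ 𝟎        = refl
subT-subT σ τ (𝐒 t)    = cong 𝐒 (subT-subT σ τ t)
subT-subT σ τ (s ⊕ t)  = cong₂ _⊕_ (subT-subT σ τ s) (subT-subT σ τ t)
subT-subT σ τ (s ⊗ t)  = cong₂ _⊗_ (subT-subT σ τ s) (subT-subT σ τ t)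
subT-subT σ τ (s ^' t) = cong₂ _^'_ (subT-subT σ τ s) (subT-subT σ τ t)

renT-as-subT : ∀ ρ t → renT ρ t ≡ subT (var ∘ ρ) t
renT-as-subT ρ (var n)  = refl
renT-as-subT ρ 𝟎        = refl
renT-as-subT ρ (𝐒 t)    = cong 𝐒 (renT-as-subT ρ t)
renT-as-subT ρ (s ⊕ t)  = cong₂ _⊕_ (renT-as-subT ρ s) (renT-as-subT ρ t)
renT-as-subT ρ (s ⊗ t)  = cong₂ _⊗_ (renT-as-subT ρ s) (renT-as-subT ρ t)
renT-as-subT ρ (s ^' t) = cong₂ _^'_ (renT-as-subT ρ s) (renT-as-subT ρ t)

subT-renT : ∀ σ ρ t → subT σ (renT ρ t) ≡ subT (σ ∘ ρ) t
subT-renT σ ρ t = trans (cong (subT σ) (renT-as-subT ρ t)) (subT-subT σ (var ∘ ρ) t)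

renT-subT : ∀ ρ σ t → renT ρ (subT σ t) ≡ subT (renT ρ ∘ σ) t
renT-subT ρ σ t = trans (renT-as-subT ρ (subT σ t))
  (trans (subT-subT (var ∘ ρ) σ t) (sym (subT-cong (renT-as-subT ρ ∘ σ) t)))

liftS-subT : ∀ σ τ → subT (liftS σ) ∘ liftS τ ≗ liftS (subT σ ∘ τ)
liftS-subT σ τ zero    = refl
liftS-subT σ τ (suc n) = trans (subT-renT (liftS σ) suc (τ n)) (sym (renT-subT suc σ (τ n)))

sub-sub : ∀ σ τ φ → sub σ (sub τ φ) ≡ sub (subT σ ∘ τ) φ
sub-sub σ τ (s ≐ t)  = cong₂ _≐_ (subT-subT σ τ s) (subT-subT σ τ t)
sub-sub σ τ (s ≼ t)  = cong₂ _≼_ (subT-subT σ τ s) (subT-subT σ τ t)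
sub-sub σ τ ⊥'       = refl
sub-sub σ τ (φ ⇒ ψ)  = cong₂ _⇒_ (sub-sub σ τ φ) (sub-sub σ τ ψ)
sub-sub σ τ (φ ∧' ψ) = cong₂ _∧'_ (sub-sub σ τ φ) (sub-sub σ τ ψ)
sub-sub σ τ (φ ∨' ψ) = cong₂ _∨'_ (sub-sub σ τ φ) (sub-sub σ τ ψ)
sub-sub σ τ (∀' φ)   = cong ∀' (trans (sub-sub (liftS σ) (liftS τ) φ) (sub-cong (liftS-subT σ τ) φ))
sub-sub σ τ (∃' φ)   = cong ∃' (trans (sub-sub (liftS σ) (liftS τ) φ) (sub-cong (liftS-subT σ τ) φ))

liftS-var : liftS var ≗ var
liftS-var zero    = refl
liftS-var (suc n) = refl

sub-var : ∀ φ → sub var φ ≡ φ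
sub-var (s ≐ t)  = cong₂ _≐_ (subT-var s) (subT-var t)
sub-var (s ≼ t)  = cong₂ _≼_ (subT-var s) (subT-var t)
sub-var ⊥'       = refl
sub-var (φ ⇒ ψ)  = cong₂ _⇒_ (sub-var φ) (sub-var ψ)
sub-var (φ ∧' ψ) = cong₂ _∧'_ (sub-var φ) (sub-var ψ)
sub-var (φ ∨' ψ) = cong₂ _∨'_ (sub-var φ) (sub-var ψ)
sub-var (∀' φ)   = cong ∀' (trans (sub-cong liftS-var φ) (sub-var φ))
sub-var (∃' φ)   = cong ∃' (trans (sub-cong liftS-var φ) (sub-var φ))

inst-liftS : ∀ u σ φ → sub (liftS σ) φ [ u ] ≡ sub (u ∙ σ) φ
inst-liftS u σ φ = trans (sub-sub (inst u) (liftS σ) φ) (sub-cong pointwise φ)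
  where
  pointwise : subT (inst u) ∘ liftS σ ≗ u ∙ σ
  pointwise zero    = refl
  pointwise (suc n) = trans (subT-renT (inst u) suc (σ n)) (subT-var (σ n))

subT-inst-renT : ∀ r t → subT (inst r) (renT suc t) ≡ t
subT-inst-renT r t = trans (subT-renT (inst r) suc t) (subT-var t)

sub-inst : ∀ σ t φ → sub σ (φ [ t ]) ≡ sub (liftS σ) φ [ subT σ t ]
sub-inst σ t φ =
  trans (sub-sub σ (inst t) φ) (trans (sub-cong pointwise φ) (sym (inst-liftS (subT σ t) σ φ)))
  where
  pointwise : subT σ ∘ inst t ≗ subT σ t ∙ σ
  pointwise zero    = refl
  pointwise (suc n) = refl

sub-shift : ∀ σ ψ → sub (liftS σ) (shift ψ) ≡ shift (sub σ ψ)
sub-shift σ ψ = trans (sub-sub (liftS σ) (var ∘ suc) ψ)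
  (trans (sub-cong (renT-as-subT suc ∘ σ) ψ) (sym (sub-sub (var ∘ suc) σ ψ)))

⊢-weaken : Γ ⊆ Δ → Γ ⊢ φ → Δ ⊢ φ
⊢-weaken h (Defs.ax p)         = Defs.ax (h p)
⊢-weaken h (Defs.raa d)        = Defs.raa (⊢-weaken (∷⁺ʳ _ h) d)
⊢-weaken h (Defs.⇒I d)         = Defs.⇒I (⊢-weaken (∷⁺ʳ _ h) d)
⊢-weaken h (Defs.⇒E d e)       = Defs.⇒E (⊢-weaken h d) (⊢-weaken h e)
⊢-weaken h (Defs.∧I d e)       = Defs.∧I (⊢-weaken h d) (⊢-weaken h e)
⊢-weaken h (Defs.∧E₁ d)        = Defs.∧E₁ (⊢-weaken h d)
⊢-weaken h (Defs.∧E₂ d)        = Defs.∧E₂ (⊢-weaken h d)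
⊢-weaken h (Defs.∨I₁ d)        = Defs.∨I₁ (⊢-weaken h d)
⊢-weaken h (Defs.∨I₂ d)        = Defs.∨I₂ (⊢-weaken h d)
⊢-weaken h (Defs.∨E d e f)     = Defs.∨E (⊢-weaken h d) (⊢-weaken (∷⁺ʳ _ h) e) (⊢-weaken (∷⁺ʳ _ h) f)
⊢-weaken h (Defs.∀I d)         = Defs.∀I (⊢-weaken (map⁺ shift h) d)
⊢-weaken h (Defs.∀E t d)       = Defs.∀E t (⊢-weaken h d)
⊢-weaken h (Defs.∃I t d)       = Defs.∃I t (⊢-weaken h d)
⊢-weaken h (Defs.∃E d e)       = Defs.∃E (⊢-weaken h d) (⊢-weaken (∷⁺ʳ _ (map⁺ shift h)) e)
⊢-weaken h (Defs.≐refl t)      = Defs.≐refl t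
⊢-weaken h (Defs.≐subst d e)   = Defs.≐subst (⊢-weaken h d) (⊢-weaken h e)

map-sub-shift : ∀ σ Γ → map (sub (liftS σ)) (map shift Γ) ≡ map shift (map (sub σ) Γ)
map-sub-shift σ []      = refl
map-sub-shift σ (ψ ∷ Γ) = cong₂ _∷_ (sub-shift σ ψ) (map-sub-shift σ Γ)

⊢-sub : ∀ σ → Γ ⊢ φ → map (sub σ) Γ ⊢ sub σ φ
⊢-sub σ (Defs.ax p)       = Defs.ax (∈-map⁺ (sub σ) p)
⊢-sub σ (Defs.raa d)      = Defs.raa (⊢-sub σ d)
⊢-sub σ (Defs.⇒I d)       = Defs.⇒I (⊢-sub σ d)
⊢-sub σ (Defs.⇒E d e)     = Defs.⇒E (⊢-sub σ d) (⊢-sub σ e)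
⊢-sub σ (Defs.∧I d e)     = Defs.∧I (⊢-sub σ d) (⊢-sub σ e)
⊢-sub σ (Defs.∧E₁ d)      = Defs.∧E₁ (⊢-sub σ d)
⊢-sub σ (Defs.∧E₂ d)      = Defs.∧E₂ (⊢-sub σ d)
⊢-sub σ (Defs.∨I₁ d)      = Defs.∨I₁ (⊢-sub σ d)
⊢-sub σ (Defs.∨I₂ d)      = Defs.∨I₂ (⊢-sub σ d)
⊢-sub σ (Defs.∨E d e f)   = Defs.∨E (⊢-sub σ d) (⊢-sub σ e) (⊢-sub σ f)
⊢-sub {Γ} σ (Defs.∀I {φ = φ} d) =
  Defs.∀I (subst (_⊢ sub (liftS σ) φ) (map-sub-shift σ Γ) (⊢-sub (liftS σ) d))
⊢-sub {Γ} σ (Defs.∀E {φ = φ} t d) =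
  subst (map (sub σ) Γ ⊢_) (sym (sub-inst σ t φ)) (Defs.∀E (subT σ t) (⊢-sub σ d))
⊢-sub {Γ} σ (Defs.∃I {φ = φ} t d) =
  Defs.∃I (subT σ t) (subst (map (sub σ) Γ ⊢_) (sub-inst σ t φ) (⊢-sub σ d))
⊢-sub {Γ} σ (Defs.∃E {φ = φ} {ψ} d e) = Defs.∃E (⊢-sub σ d)
  (subst₂ (λ Θ χ → sub (liftS σ) φ ∷ Θ ⊢ χ) (map-sub-shift σ Γ) (sub-shift σ ψ) (⊢-sub (liftS σ) e))
⊢-sub σ (Defs.≐refl t)    = Defs.≐refl (subT σ t)
⊢-sub {Γ} σ (Defs.≐subst {φ = φ} {s} {t} d e) =
  subst (map (sub σ) Γ ⊢_) (sym (sub-inst σ t φ))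
    (Defs.≐subst {φ = sub (liftS σ) φ} (⊢-sub σ d) (subst (map (sub σ) Γ ⊢_) (sub-inst σ s φ) (⊢-sub σ e)))

Closed : Formula → Set
Closed ψ = shift ψ ≡ ψ

Axiom : Formula → Set
Axiom ψ = IOpenExp ψ × Closed ψ

-- The axioms used are carried beside the hypotheses; being closed, they are
-- unaffected by the shift of the context at ∀-introduction and ∃-elimination.
infix 0 _⊢ᴵ_
_⊢ᴵ_ : List Formula → Formula → Set
Γ ⊢ᴵ φ = Σ (List Formula) λ Δ → All Axiom Δ × (Γ ++ Δ ⊢ φ)

map-shift-closed : All Axiom Δ → map shift Δ ≡ Δ
map-shift-closed []             = refl
map-shift-closed ((_ , c) ∷ as) = cong₂ _∷_ c (map-shift-closed as)

map-shift-++-closed : ∀ Γ → All Axiom Δ → map shift (Γ ++ Δ) ≡ map shift Γ ++ Δ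
map-shift-++-closed Γ as = trans (map-++ shift Γ _) (cong (map shift Γ ++_) (map-shift-closed as))

private
  variable
    Γ₁ Γ₂ : List Formula
    φ₁ φ₂ φ₃ : Formula

  lift₁ : (∀ {Δ} → Γ₁ ++ Δ ⊢ φ₁ → Γ ++ Δ ⊢ φ₃) → Γ₁ ⊢ᴵ φ₁ → Γ ⊢ᴵ φ₃
  lift₁ r (Δ , as , d) = Δ , as , r d

  lift₂ : (∀ {Δ} → Γ₁ ++ Δ ⊢ φ₁ → Γ₂ ++ Δ ⊢ φ₂ → Γ ++ Δ ⊢ φ₃) → Γ₁ ⊢ᴵ φ₁ → Γ₂ ⊢ᴵ φ₂ → Γ ⊢ᴵ φ₃
  lift₂ {Γ₁ = Γ₁} {Γ₂ = Γ₂} r (Δ₁ , as₁ , d₁) (Δ₂ , as₂ , d₂) =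
    Δ₁ ++ Δ₂ , ++⁺ as₁ as₂ ,
    r (⊢-weaken (++⁺ʳ Γ₁ (xs⊆xs++ys Δ₁ Δ₂)) d₁) (⊢-weaken (++⁺ʳ Γ₂ (xs⊆ys++xs Δ₂ Δ₁)) d₂)

ax : φ ∈ Γ → Γ ⊢ᴵ φ
ax p = [] , [] , Defs.ax (∈-++⁺ˡ p)

raa : ¬' φ ∷ Γ ⊢ᴵ ⊥' → Γ ⊢ᴵ φ
raa = lift₁ Defs.raa

⇒I : φ ∷ Γ ⊢ᴵ ψ → Γ ⊢ᴵ φ ⇒ ψ
⇒I = lift₁ Defs.⇒I

⇒E : Γ ⊢ᴵ φ ⇒ ψ → Γ ⊢ᴵ φ → Γ ⊢ᴵ ψ
⇒E = lift₂ Defs.⇒E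

∧I : Γ ⊢ᴵ φ → Γ ⊢ᴵ ψ → Γ ⊢ᴵ φ ∧' ψ
∧I = lift₂ Defs.∧I

∧E₁ : Γ ⊢ᴵ φ ∧' ψ → Γ ⊢ᴵ φ
∧E₁ = lift₁ Defs.∧E₁

∧E₂ : Γ ⊢ᴵ φ ∧' ψ → Γ ⊢ᴵ ψ
∧E₂ = lift₁ Defs.∧E₂

∨I₁ : Γ ⊢ᴵ φ → Γ ⊢ᴵ φ ∨' ψ
∨I₁ = lift₁ Defs.∨I₁

∨I₂ : Γ ⊢ᴵ ψ → Γ ⊢ᴵ φ ∨' ψ
∨I₂ = lift₁ Defs.∨I₂

-- The two branches are packed into (φ ⇒ χ) ∧' (ψ ⇒ χ), so that lift₂ suffices.
∨E : Γ ⊢ᴵ φ ∨' ψ → φ ∷ Γ ⊢ᴵ χ → ψ ∷ Γ ⊢ᴵ χ → Γ ⊢ᴵ χ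
∨E d e f = lift₂ (λ d′ e′ → Defs.∨E d′ (Defs.⇒E (Defs.∧E₁ (⊢-weaken there e′)) (Defs.ax (here refl)))
                                     (Defs.⇒E (Defs.∧E₂ (⊢-weaken there e′)) (Defs.ax (here refl))))
             d (lift₂ (λ e′ f′ → Defs.∧I (Defs.⇒I e′) (Defs.⇒I f′)) e f)

∀I : map shift Γ ⊢ᴵ φ → Γ ⊢ᴵ ∀' φ
∀I {Γ} {φ} (Δ , as , d) = Δ , as , Defs.∀I (subst (_⊢ φ) (sym (map-shift-++-closed Γ as)) d)

∀E : ∀ t → Γ ⊢ᴵ ∀' φ → Γ ⊢ᴵ φ [ t ]
∀E t = lift₁ (Defs.∀E t)

∃I : ∀ t → Γ ⊢ᴵ φ [ t ] → Γ ⊢ᴵ ∃' φ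
∃I t = lift₁ (Defs.∃I t)

∃E : Γ ⊢ᴵ ∃' φ → φ ∷ map shift Γ ⊢ᴵ shift ψ → Γ ⊢ᴵ ψ
∃E {Γ} {φ} {ψ} (Δ₁ , as₁ , d) (Δ₂ , as₂ , e) =
  Δ₁ ++ Δ₂ , as , Defs.∃E (⊢-weaken (++⁺ʳ Γ (xs⊆xs++ys Δ₁ Δ₂)) d)
    (subst (λ Θ → φ ∷ Θ ⊢ shift ψ) (sym (map-shift-++-closed Γ as))
      (⊢-weaken (++⁺ʳ (φ ∷ map shift Γ) (xs⊆ys++xs Δ₂ Δ₁)) e))
  where
  as = ++⁺ as₁ as₂

≐refl : ∀ t → Γ ⊢ᴵ t ≐ t
≐refl t = [] , [] , Defs.≐refl t

≐subst : Γ ⊢ᴵ s ≐ t → Γ ⊢ᴵ φ [ s ] → Γ ⊢ᴵ φ [ t ]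
≐subst {φ = φ} = lift₂ (Defs.≐subst {φ = φ})

axiom : IOpenExp ψ → Closed ψ → Γ ⊢ᴵ ψ
axiom {Γ = Γ} p c = _ ∷ [] , (p , c) ∷ [] , Defs.ax (∈-++⁺ʳ Γ (here refl))

weaken : Γ ⊆ Δ → Γ ⊢ᴵ φ → Δ ⊢ᴵ φ
weaken h (Θ , as , d) = Θ , as , ⊢-weaken (++⁺ˡ Θ h) d

⊢ᴵ-shift : Γ ⊢ᴵ φ → map shift Γ ⊢ᴵ shift φ
⊢ᴵ-shift {Γ} {φ} (Δ , as , d) = Δ , as , subst (_⊢ shift φ) (map-shift-++-closed Γ as) (⊢-sub (var ∘ suc) d)

⊢ᴵ⇒⊩ : [] ⊢ᴵ φ → IOpenExp ⊩ φ
⊢ᴵ⇒⊩ (Δ , as , d) = Δ , All.map proj₁ as , d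

hyp : φ ∷ Γ ⊢ᴵ φ
hyp = ax (here refl)

hyp₁ : ψ ∷ φ ∷ Γ ⊢ᴵ φ
hyp₁ = ax (there (here refl))

hyp₂ : χ ∷ ψ ∷ φ ∷ Γ ⊢ᴵ φ
hyp₂ = ax (there (there (here refl)))

hyp₃ : ω ∷ χ ∷ ψ ∷ φ ∷ Γ ⊢ᴵ φ
hyp₃ = ax (there (there (there (here refl))))

wk₁ : Γ ⊢ᴵ φ → ψ ∷ Γ ⊢ᴵ φ
wk₁ = weaken there

wk₂ : Γ ⊢ᴵ φ → χ ∷ ψ ∷ Γ ⊢ᴵ φ
wk₂ = wk₁ ∘ wk₁

wk-shift : Γ ⊢ᴵ φ → ψ ∷ map shift Γ ⊢ᴵ shift φ
wk-shift = wk₁ ∘ ⊢ᴵ-shift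

⊥E : Γ ⊢ᴵ ⊥' → Γ ⊢ᴵ φ
⊥E d = raa (wk₁ d)

contradiction : Γ ⊢ᴵ φ → Γ ⊢ᴵ ¬' φ → Γ ⊢ᴵ ψ
contradiction d e = ⊥E (⇒E e d)

excluded-middle : ∀ φ → Γ ⊢ᴵ φ ∨' ¬' φ
excluded-middle φ = raa (⇒E hyp (∨I₂ (⇒I (⇒E (wk₁ hyp) (∨I₁ hyp)))))

by-cases : ∀ φ → φ ∷ Γ ⊢ᴵ ψ → ¬' φ ∷ Γ ⊢ᴵ ψ → Γ ⊢ᴵ ψ
by-cases φ = ∨E (excluded-middle φ)

∀^-suc : ∀ k ψ → ∀^ (suc k) ψ ≡ ∀^ k (∀' ψ)
∀^-suc zero    ψ = refl
∀^-suc (suc k) ψ = cong ∀' (∀^-suc k ψ)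

∀^E : ∀ k ψ → Γ ⊢ᴵ ∀^ k ψ → (ts : Vec Term k) → Γ ⊢ᴵ sub (fromVec ts) ψ
∀^E zero    ψ d []       = subst (_ ⊢ᴵ_) (sym (sub-var ψ)) d
∀^E (suc k) ψ d (t ∷ ts) =
  subst (_ ⊢ᴵ_) (inst-liftS t (fromVec ts) ψ) (∀E t (∀^E k (∀' ψ) (subst (_ ⊢ᴵ_) (∀^-suc k ψ) d) ts))

replace : ∀ φ σ → Γ ⊢ᴵ s ≐ t → Γ ⊢ᴵ sub (s ∙ σ) φ → Γ ⊢ᴵ sub (t ∙ σ) φ
replace {Γ} {s} {t} φ σ e d =
  subst (Γ ⊢ᴵ_) (inst-liftS t σ φ)
    (≐subst {φ = sub (liftS σ) φ} e (subst (Γ ⊢ᴵ_) (sym (inst-liftS s σ φ)) d))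

≐-sym : Γ ⊢ᴵ s ≐ t → Γ ⊢ᴵ t ≐ s
≐-sym {s = s} e = replace (v0 ≐ v1) (s ∙ var) e (≐refl s)

≐-trans : Γ ⊢ᴵ s ≐ t → Γ ⊢ᴵ t ≐ u → Γ ⊢ᴵ s ≐ u
≐-trans {s = s} e e′ = replace (v1 ≐ v0) (s ∙ var) e′ e

cong-𝐒 : Γ ⊢ᴵ s ≐ t → Γ ⊢ᴵ 𝐒 s ≐ 𝐒 t
cong-𝐒 {s = s} e = replace (𝐒 v1 ≐ 𝐒 v0) (s ∙ var) e (≐refl _)

cong-⊕ˡ : ∀ u → Γ ⊢ᴵ s ≐ t → Γ ⊢ᴵ s ⊕ u ≐ t ⊕ u
cong-⊕ˡ {s = s} u e = replace (v1 ⊕ v2 ≐ v0 ⊕ v2) (s ∙ u ∙ var) e (≐refl _)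

cong-⊕ʳ : ∀ u → Γ ⊢ᴵ s ≐ t → Γ ⊢ᴵ u ⊕ s ≐ u ⊕ t
cong-⊕ʳ {s = s} u e = replace (v2 ⊕ v1 ≐ v2 ⊕ v0) (s ∙ u ∙ var) e (≐refl _)

cong-⊗ˡ : ∀ u → Γ ⊢ᴵ s ≐ t → Γ ⊢ᴵ s ⊗ u ≐ t ⊗ u
cong-⊗ˡ {s = s} u e = replace (v1 ⊗ v2 ≐ v0 ⊗ v2) (s ∙ u ∙ var) e (≐refl _)

cong-⊗ʳ : ∀ u → Γ ⊢ᴵ s ≐ t → Γ ⊢ᴵ u ⊗ s ≐ u ⊗ t
cong-⊗ʳ {s = s} u e = replace (v2 ⊗ v1 ≐ v2 ⊗ v0) (s ∙ u ∙ var) e (≐refl _)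

cong-^ˡ : ∀ u → Γ ⊢ᴵ s ≐ t → Γ ⊢ᴵ s ^' u ≐ t ^' u
cong-^ˡ {s = s} u e = replace (v1 ^' v2 ≐ v0 ^' v2) (s ∙ u ∙ var) e (≐refl _)

cong-^ʳ : ∀ u → Γ ⊢ᴵ s ≐ t → Γ ⊢ᴵ u ^' s ≐ u ^' t
cong-^ʳ {s = s} u e = replace (v2 ^' v1 ≐ v2 ^' v0) (s ∙ u ∙ var) e (≐refl _)

cong-⊕ : Γ ⊢ᴵ s ≐ t → Γ ⊢ᴵ s₁ ≐ t₁ → Γ ⊢ᴵ s ⊕ s₁ ≐ t ⊕ t₁
cong-⊕ {t = t} {s₁ = s₁} e e₁ = ≐-trans (cong-⊕ˡ s₁ e) (cong-⊕ʳ t e₁)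

cong-⊗ : Γ ⊢ᴵ s ≐ t → Γ ⊢ᴵ s₁ ≐ t₁ → Γ ⊢ᴵ s ⊗ s₁ ≐ t ⊗ t₁
cong-⊗ {t = t} {s₁ = s₁} e e₁ = ≐-trans (cong-⊗ˡ s₁ e) (cong-⊗ʳ t e₁)

≼-respˡ-≐ : Γ ⊢ᴵ s ≐ t → Γ ⊢ᴵ s ≼ u → Γ ⊢ᴵ t ≼ u
≼-respˡ-≐ {u = u} e d = replace (v0 ≼ v1) (u ∙ var) e d

≼-respʳ-≐ : Γ ⊢ᴵ s ≐ t → Γ ⊢ᴵ u ≼ s → Γ ⊢ᴵ u ≼ t
≼-respʳ-≐ {u = u} e d = replace (v1 ≼ v0) (u ∙ var) e d

≺-resp-≐ : Γ ⊢ᴵ s ≐ t → Γ ⊢ᴵ s₁ ≐ t₁ → Γ ⊢ᴵ s ≺ s₁ → Γ ⊢ᴵ t ≺ t₁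
≺-resp-≐ {s = s} {t₁ = t₁} e e₁ d =
  replace ((v0 ≼ v1) ∧' ¬' (v0 ≐ v1)) (t₁ ∙ var) e (replace ((v1 ≼ v0) ∧' ¬' (v1 ≐ v0)) (s ∙ var) e₁ d)

module ≐-Reasoning where
  infixr 2 _≐⟨_⟩_
  infix  3 _∎

  _≐⟨_⟩_ : ∀ s → Γ ⊢ᴵ s ≐ t → Γ ⊢ᴵ t ≐ u → Γ ⊢ᴵ s ≐ u
  s ≐⟨ e ⟩ e′ = ≐-trans e e′

  _∎ : ∀ s → Γ ⊢ᴵ s ≐ s
  s ∎ = ≐refl s

S≢0 : ∀ s → Γ ⊢ᴵ ¬' (𝐒 s ≐ 𝟎)
S≢0 s = ∀^E 1 _ (axiom Q1 refl) (s ∷ [])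

S-injective : Γ ⊢ᴵ 𝐒 s ≐ 𝐒 t → Γ ⊢ᴵ s ≐ t
S-injective {s = s} {t} = ⇒E (∀^E 2 _ (axiom Q2 refl) (s ∷ t ∷ []))

+-identityʳ : ∀ s → Γ ⊢ᴵ s ⊕ 𝟎 ≐ s
+-identityʳ s = ∀^E 1 _ (axiom Q4 refl) (s ∷ [])

+-suc : ∀ s t → Γ ⊢ᴵ s ⊕ 𝐒 t ≐ 𝐒 (s ⊕ t)
+-suc s t = ∀^E 2 _ (axiom Q5 refl) (s ∷ t ∷ [])

*-zeroʳ : ∀ s → Γ ⊢ᴵ s ⊗ 𝟎 ≐ 𝟎
*-zeroʳ s = ∀^E 1 _ (axiom Q6 refl) (s ∷ [])

*-suc : ∀ s t → Γ ⊢ᴵ s ⊗ 𝐒 t ≐ s ⊗ t ⊕ s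
*-suc s t = ∀^E 2 _ (axiom Q7 refl) (s ∷ t ∷ [])

^-zero : ∀ s → Γ ⊢ᴵ s ^' 𝟎 ≐ 𝟏
^-zero s = ∀^E 1 _ (axiom P1 refl) (s ∷ [])

^-suc : ∀ s t → Γ ⊢ᴵ s ^' 𝐒 t ≐ (s ^' t) ⊗ s
^-suc s t = ∀^E 2 _ (axiom P2 refl) (t ∷ s ∷ [])

≼-intro : ∀ r → Γ ⊢ᴵ r ⊕ s ≐ t → Γ ⊢ᴵ s ≼ t
≼-intro {Γ} {s} {t} r d = ⇒E (∧E₂ (∀^E 2 _ (axiom Q8 refl) (s ∷ t ∷ [])))
  (∃I r (subst (Γ ⊢ᴵ_) (sym (cong₂ (λ a b → r ⊕ a ≐ b) (subT-inst-renT r s) (subT-inst-renT r t))) d))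

≼-elim : Γ ⊢ᴵ s ≼ t → (var 0 ⊕ shiftT s ≐ shiftT t) ∷ map shift Γ ⊢ᴵ shift ψ → Γ ⊢ᴵ ψ
≼-elim {Γ} {s} {t} {ψ} d k = ∃E (⇒E (∧E₁ (∀^E 2 _ (axiom Q8 refl) (s ∷ t ∷ []))) d)
  (subst (λ χ → χ ∷ map shift Γ ⊢ᴵ shift ψ)
     (sym (cong₂ (λ a b → var 0 ⊕ a ≐ b) (renT-as-subT suc s) (renT-as-subT suc t))) k)

zero-or-suc : ∀ s → (s ≐ 𝟎) ∷ Γ ⊢ᴵ ψ → (shiftT s ≐ 𝐒 (var 0)) ∷ map shift Γ ⊢ᴵ shift ψ → Γ ⊢ᴵ ψ
zero-or-suc {Γ} {ψ} s z k = by-cases (s ≐ 𝟎) z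
  (∃E (⇒E (∀^E 1 _ (axiom Q3 refl) (s ∷ [])) hyp)
      (weaken (∷⁺ʳ _ there)
        (subst (λ a → (a ≐ 𝐒 (var 0)) ∷ map shift Γ ⊢ᴵ shift ψ) (sym (renT-as-subT suc s)) k)))

-- In φ, var 0 is the induction variable and var (suc i) the i-th parameter, instantiated by ts.
induction : ∀ {k} φ → QF φ → (ts : Vec Term k) → Closed (∀^ k (indAx φ)) →
  Γ ⊢ᴵ sub (𝟎 ∙ fromVec ts) φ →
  sub (var 0 ∙ shiftT ∘ fromVec ts) φ ∷ map shift Γ ⊢ᴵ sub (𝐒 (var 0) ∙ shiftT ∘ fromVec ts) φ →
  ∀ u → Γ ⊢ᴵ sub (u ∙ fromVec ts) φ
induction {Γ} {k} φ qf ts closed base step u =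
  subst (Γ ⊢ᴵ_) (inst-liftS u θ φ)
    (∀E u (⇒E (∀^E k (indAx φ) (axiom (Ind k φ qf) closed) ts)
      (∧I (subst (Γ ⊢ᴵ_) (sym base-eq) base)
          (∀I (⇒I (subst₂ (λ χ χ′ → χ ∷ map shift Γ ⊢ᴵ χ′) (sym hyp-eq) (sym step-eq) step))))))
  where
  θ = fromVec ts
  base-eq : sub θ (φ [ 𝟎 ]) ≡ sub (𝟎 ∙ θ) φ
  base-eq = trans (sub-sub θ (inst 𝟎) φ) (sub-cong pointwise φ)
    where
    pointwise : subT θ ∘ inst 𝟎 ≗ 𝟎 ∙ θ
    pointwise zero    = refl
    pointwise (suc n) = refl
  liftS-shift : liftS θ ≗ var 0 ∙ shiftT ∘ θ
  liftS-shift zero    = refl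
  liftS-shift (suc n) = renT-as-subT suc (θ n)
  hyp-eq : sub (liftS θ) φ ≡ sub (var 0 ∙ shiftT ∘ θ) φ
  hyp-eq = sub-cong liftS-shift φ
  step-eq : sub (liftS θ) (sub succ0 φ) ≡ sub (𝐒 (var 0) ∙ shiftT ∘ θ) φ
  step-eq = trans (sub-sub (liftS θ) succ0 φ) (sub-cong pointwise φ)
    where
    pointwise : subT (liftS θ) ∘ succ0 ≗ 𝐒 (var 0) ∙ shiftT ∘ θ
    pointwise zero    = refl
    pointwise (suc n) = liftS-shift (suc n)

-- Semiring laws

+-identityˡ : ∀ t → Γ ⊢ᴵ 𝟎 ⊕ t ≐ t
+-identityˡ = induction (𝟎 ⊕ v0 ≐ v0) (qf-≐ _ _) [] refl
  (+-identityʳ 𝟎)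
  (≐-trans (+-suc 𝟎 (var 0)) (cong-𝐒 hyp))

suc-+ : ∀ s t → Γ ⊢ᴵ 𝐒 s ⊕ t ≐ 𝐒 (s ⊕ t)
suc-+ s = induction (𝐒 v1 ⊕ v0 ≐ 𝐒 (v1 ⊕ v0)) (qf-≐ _ _) (s ∷ []) refl
  (≐-trans (+-identityʳ (𝐒 s)) (cong-𝐒 (≐-sym (+-identityʳ s))))
  (≐-trans (+-suc (𝐒 s′) v) (≐-trans (cong-𝐒 hyp) (cong-𝐒 (≐-sym (+-suc s′ v)))))
  where
  s′ = shiftT s
  v = var 0

+-comm : ∀ s t → Γ ⊢ᴵ s ⊕ t ≐ t ⊕ s
+-comm s = induction (v1 ⊕ v0 ≐ v0 ⊕ v1) (qf-≐ _ _) (s ∷ []) refl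
  (≐-trans (+-identityʳ s) (≐-sym (+-identityˡ s)))
  (≐-trans (+-suc s′ v) (≐-trans (cong-𝐒 hyp) (≐-sym (suc-+ v s′))))
  where
  s′ = shiftT s
  v = var 0

+-assoc : ∀ s t u → Γ ⊢ᴵ (s ⊕ t) ⊕ u ≐ s ⊕ (t ⊕ u)
+-assoc s t = induction ((v1 ⊕ v2) ⊕ v0 ≐ v1 ⊕ (v2 ⊕ v0)) (qf-≐ _ _) (s ∷ t ∷ []) refl
  (≐-trans (+-identityʳ (s ⊕ t)) (≐-sym (cong-⊕ʳ s (+-identityʳ t))))
  ((s′ ⊕ t′) ⊕ 𝐒 v  ≐⟨ +-suc (s′ ⊕ t′) v ⟩
   𝐒 ((s′ ⊕ t′) ⊕ v) ≐⟨ cong-𝐒 hyp ⟩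
   𝐒 (s′ ⊕ (t′ ⊕ v)) ≐⟨ ≐-sym (+-suc s′ (t′ ⊕ v)) ⟩
   s′ ⊕ 𝐒 (t′ ⊕ v)   ≐⟨ cong-⊕ʳ s′ (≐-sym (+-suc t′ v)) ⟩
   s′ ⊕ (t′ ⊕ 𝐒 v)   ∎)
  where
  open ≐-Reasoning
  s′ = shiftT s
  t′ = shiftT t
  v = var 0

*-zeroˡ : ∀ t → Γ ⊢ᴵ 𝟎 ⊗ t ≐ 𝟎
*-zeroˡ = induction (𝟎 ⊗ v0 ≐ 𝟎) (qf-≐ _ _) [] refl
  (*-zeroʳ 𝟎)
  (≐-trans (*-suc 𝟎 (var 0)) (≐-trans (+-identityʳ (𝟎 ⊗ var 0)) hyp))

suc-* : ∀ s t → Γ ⊢ᴵ 𝐒 s ⊗ t ≐ s ⊗ t ⊕ t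
suc-* s = induction (𝐒 v1 ⊗ v0 ≐ v1 ⊗ v0 ⊕ v0) (qf-≐ _ _) (s ∷ []) refl
  (≐-trans (*-zeroʳ (𝐒 s)) (≐-sym (≐-trans (+-identityʳ (s ⊗ 𝟎)) (*-zeroʳ s))))
  (𝐒 s′ ⊗ 𝐒 v             ≐⟨ *-suc (𝐒 s′) v ⟩
   𝐒 s′ ⊗ v ⊕ 𝐒 s′         ≐⟨ cong-⊕ˡ (𝐒 s′) hyp ⟩
   (s′ ⊗ v ⊕ v) ⊕ 𝐒 s′     ≐⟨ +-suc _ s′ ⟩
   𝐒 ((s′ ⊗ v ⊕ v) ⊕ s′)   ≐⟨ cong-𝐒 (+-assoc _ v s′) ⟩
   𝐒 (s′ ⊗ v ⊕ (v ⊕ s′))   ≐⟨ cong-𝐒 (cong-⊕ʳ (s′ ⊗ v) (+-comm v s′)) ⟩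
   𝐒 (s′ ⊗ v ⊕ (s′ ⊕ v))   ≐⟨ cong-𝐒 (≐-sym (+-assoc _ s′ v)) ⟩
   𝐒 ((s′ ⊗ v ⊕ s′) ⊕ v)   ≐⟨ ≐-sym (+-suc _ v) ⟩
   (s′ ⊗ v ⊕ s′) ⊕ 𝐒 v     ≐⟨ cong-⊕ˡ (𝐒 v) (≐-sym (*-suc s′ v)) ⟩
   s′ ⊗ 𝐒 v ⊕ 𝐒 v         ∎)
  where
  open ≐-Reasoning
  s′ = shiftT s
  v = var 0

*-comm : ∀ s t → Γ ⊢ᴵ s ⊗ t ≐ t ⊗ s
*-comm s = induction (v1 ⊗ v0 ≐ v0 ⊗ v1) (qf-≐ _ _) (s ∷ []) refl
  (≐-trans (*-zeroʳ s) (≐-sym (*-zeroˡ s)))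
  (≐-trans (*-suc s′ v) (≐-trans (cong-⊕ˡ s′ hyp) (≐-sym (suc-* v s′))))
  where
  s′ = shiftT s
  v = var 0

*-distribˡ-+ : ∀ s t u → Γ ⊢ᴵ s ⊗ (t ⊕ u) ≐ s ⊗ t ⊕ s ⊗ u
*-distribˡ-+ s t = induction (v1 ⊗ (v2 ⊕ v0) ≐ v1 ⊗ v2 ⊕ v1 ⊗ v0) (qf-≐ _ _) (s ∷ t ∷ []) refl
  (≐-trans (cong-⊗ʳ s (+-identityʳ t))
    (≐-trans (≐-sym (+-identityʳ (s ⊗ t))) (cong-⊕ʳ (s ⊗ t) (≐-sym (*-zeroʳ s)))))
  (s′ ⊗ (t′ ⊕ 𝐒 v)              ≐⟨ cong-⊗ʳ s′ (+-suc t′ v) ⟩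
   s′ ⊗ 𝐒 (t′ ⊕ v)              ≐⟨ *-suc s′ _ ⟩
   s′ ⊗ (t′ ⊕ v) ⊕ s′           ≐⟨ cong-⊕ˡ s′ hyp ⟩
   (s′ ⊗ t′ ⊕ s′ ⊗ v) ⊕ s′      ≐⟨ +-assoc _ _ _ ⟩
   s′ ⊗ t′ ⊕ (s′ ⊗ v ⊕ s′)      ≐⟨ cong-⊕ʳ (s′ ⊗ t′) (≐-sym (*-suc s′ v)) ⟩
   s′ ⊗ t′ ⊕ s′ ⊗ 𝐒 v           ∎)
  where
  open ≐-Reasoning
  s′ = shiftT s
  t′ = shiftT t
  v = var 0

*-distribʳ-+ : ∀ s t u → Γ ⊢ᴵ (s ⊕ t) ⊗ u ≐ s ⊗ u ⊕ t ⊗ u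
*-distribʳ-+ s t u =
  ≐-trans (*-comm _ u) (≐-trans (*-distribˡ-+ u s t) (cong-⊕ (*-comm u s) (*-comm u t)))

*-assoc : ∀ s t u → Γ ⊢ᴵ (s ⊗ t) ⊗ u ≐ s ⊗ (t ⊗ u)
*-assoc s t = induction ((v1 ⊗ v2) ⊗ v0 ≐ v1 ⊗ (v2 ⊗ v0)) (qf-≐ _ _) (s ∷ t ∷ []) refl
  (≐-trans (*-zeroʳ _) (≐-sym (≐-trans (cong-⊗ʳ s (*-zeroʳ t)) (*-zeroʳ s))))
  ((s′ ⊗ t′) ⊗ 𝐒 v            ≐⟨ *-suc _ v ⟩
   (s′ ⊗ t′) ⊗ v ⊕ s′ ⊗ t′    ≐⟨ cong-⊕ˡ (s′ ⊗ t′) hyp ⟩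
   s′ ⊗ (t′ ⊗ v) ⊕ s′ ⊗ t′    ≐⟨ ≐-sym (*-distribˡ-+ s′ _ _) ⟩
   s′ ⊗ (t′ ⊗ v ⊕ t′)         ≐⟨ cong-⊗ʳ s′ (≐-sym (*-suc t′ v)) ⟩
   s′ ⊗ (t′ ⊗ 𝐒 v)            ∎)
  where
  open ≐-Reasoning
  s′ = shiftT s
  t′ = shiftT t
  v = var 0

*-identityʳ : ∀ s → Γ ⊢ᴵ s ⊗ 𝟏 ≐ s
*-identityʳ s = ≐-trans (*-suc s 𝟎) (≐-trans (cong-⊕ˡ s (*-zeroʳ s)) (+-identityˡ s))

*-identityˡ : ∀ s → Γ ⊢ᴵ 𝟏 ⊗ s ≐ s
*-identityˡ s = ≐-trans (*-comm 𝟏 s) (*-identityʳ s)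

+-one : ∀ s → Γ ⊢ᴵ s ⊕ 𝟏 ≐ 𝐒 s
+-one s = ≐-trans (+-suc s 𝟎) (cong-𝐒 (+-identityʳ s))

one-+ : ∀ s → Γ ⊢ᴵ 𝟏 ⊕ s ≐ 𝐒 s
one-+ s = ≐-trans (suc-+ 𝟎 s) (cong-𝐒 (+-identityˡ s))

-- Order

qf-≺ : ∀ s t → QF (s ≺ t)
qf-≺ s t = qf-∧ (qf-≼ s t) (qf-⇒ (qf-≐ s t) qf-⊥)

+-cancelʳ-≐ : ∀ u → Γ ⊢ᴵ s ⊕ u ≐ t ⊕ u → Γ ⊢ᴵ s ≐ t
+-cancelʳ-≐ {s = s} {t} u = ⇒E (induction ((v1 ⊕ v0 ≐ v2 ⊕ v0) ⇒ (v1 ≐ v2)) (qf-⇒ (qf-≐ _ _) (qf-≐ _ _))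
  (s ∷ t ∷ []) refl
  (⇒I (≐-trans (≐-sym (+-identityʳ s)) (≐-trans hyp (+-identityʳ t))))
  (⇒I (⇒E hyp₁ (S-injective (≐-trans (≐-sym (+-suc _ (var 0))) (≐-trans hyp (+-suc _ (var 0)))))))
  u)

≼-refl : ∀ s → Γ ⊢ᴵ s ≼ s
≼-refl s = ≼-intro 𝟎 (+-identityˡ s)

≼-reflexive : Γ ⊢ᴵ s ≐ t → Γ ⊢ᴵ s ≼ t
≼-reflexive {s = s} e = ≼-respʳ-≐ e (≼-refl s)

z≼n : ∀ s → Γ ⊢ᴵ 𝟎 ≼ s
z≼n s = ≼-intro s (+-identityʳ s)

s≼t⊕s : ∀ t s → Γ ⊢ᴵ s ≼ t ⊕ s
s≼t⊕s t s = ≼-intro t (≐refl (t ⊕ s))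

s≼s⊕t : ∀ s t → Γ ⊢ᴵ s ≼ s ⊕ t
s≼s⊕t s t = ≼-intro t (+-comm t s)

s≼𝐒s : ∀ s → Γ ⊢ᴵ s ≼ 𝐒 s
s≼𝐒s s = ≼-intro 𝟏 (one-+ s)

≼-trans : Γ ⊢ᴵ s ≼ t → Γ ⊢ᴵ t ≼ u → Γ ⊢ᴵ s ≼ u
≼-trans {s = s} {t} {u} d e = ≼-elim d (≼-elim {s = shiftT t} {shiftT u} (wk-shift e)
  (≼-intro (var 0 ⊕ var 1)
    (≐-trans (+-assoc (var 0) (var 1) (shiftT (shiftT s))) (≐-trans (cong-⊕ʳ (var 0) hyp₁) hyp))))

𝐒s≼s⇒⊥ : Γ ⊢ᴵ 𝐒 s ≼ s → Γ ⊢ᴵ ⊥'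
𝐒s≼s⇒⊥ {s = s} d = ≼-elim d (⇒E (S≢0 (var 0))
  (+-cancelʳ-≐ s′ (≐-trans (suc-+ (var 0) s′)
    (≐-trans (≐-sym (+-suc (var 0) s′)) (≐-trans hyp (≐-sym (+-identityˡ s′)))))))
  where
  s′ = shiftT s

𝐒-mono-≼ : Γ ⊢ᴵ s ≼ t → Γ ⊢ᴵ 𝐒 s ≼ 𝐒 t
𝐒-mono-≼ d = ≼-elim d (≼-intro (var 0) (≐-trans (+-suc _ _) (cong-𝐒 hyp)))

𝐒≼⇒≺ : Γ ⊢ᴵ 𝐒 s ≼ t → Γ ⊢ᴵ s ≺ t
𝐒≼⇒≺ {s = s} d = ∧I (≼-trans (s≼𝐒s s) d) (⇒I (𝐒s≼s⇒⊥ (≼-respʳ-≐ (≐-sym hyp) (wk₁ d))))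

≺⇒𝐒≼ : Γ ⊢ᴵ s ≺ t → Γ ⊢ᴵ 𝐒 s ≼ t
≺⇒𝐒≼ {s = s} d = ≼-elim (∧E₁ d) (zero-or-suc (var 0)
  (contradiction (≐-trans (≐-sym (≐-trans (cong-⊕ˡ (shiftT s) hyp) (+-identityˡ (shiftT s)))) hyp₁)
                 (wk₁ (wk-shift (∧E₂ d))))
  (≼-intro (var 0) (≐-trans (+-suc (var 0) _)
    (≐-trans (≐-sym (suc-+ (var 0) _)) (≐-trans (cong-⊕ˡ _ (≐-sym hyp)) hyp₁)))))

≺-irrefl : Γ ⊢ᴵ s ≺ s → Γ ⊢ᴵ ⊥'
≺-irrefl {s = s} d = ⇒E (∧E₂ d) (≐refl s)

≼-total : ∀ s t → Γ ⊢ᴵ (s ≼ t) ∨' (t ≼ s)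
≼-total s t = induction ((v0 ≼ v1) ∨' (v1 ≼ v0)) (qf-∨ (qf-≼ _ _) (qf-≼ _ _)) (t ∷ []) refl
  (∨I₁ (z≼n t))
  (∨E hyp
     (by-cases (var 0 ≐ shiftT t)
        (∨I₂ (≼-respˡ-≐ hyp (s≼𝐒s (var 0))))
        (∨I₁ (≺⇒𝐒≼ (∧I hyp₁ hyp))))
     (∨I₂ (≼-trans hyp (s≼𝐒s (var 0)))))
  s

≼-antisym : Γ ⊢ᴵ s ≼ t → Γ ⊢ᴵ t ≼ s → Γ ⊢ᴵ s ≐ t
≼-antisym {s = s} {t} d e = by-cases (s ≐ t) hyp
  (⊥E (𝐒s≼s⇒⊥ (≼-trans (≺⇒𝐒≼ (∧I (wk₁ d) hyp)) (wk₁ e))))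

¬≺⇒≽ : Γ ⊢ᴵ ¬' (s ≺ t) → Γ ⊢ᴵ t ≼ s
¬≺⇒≽ {s = s} {t} d = ∨E (≼-total s t)
  (by-cases (s ≐ t) (≼-respˡ-≐ hyp (≼-refl s)) (contradiction (∧I hyp₁ hyp) (wk₂ d)))
  hyp

¬≼⇒≻ : Γ ⊢ᴵ ¬' (s ≼ t) → Γ ⊢ᴵ t ≺ s
¬≼⇒≻ {s = s} {t} d = ∨E (≼-total s t) (contradiction hyp (wk₁ d))
  (∧I hyp (⇒I (contradiction (≼-respˡ-≐ hyp (≼-refl t)) (wk₂ d))))

≺⇒⋡ : Γ ⊢ᴵ s ≺ t → Γ ⊢ᴵ t ≼ s → Γ ⊢ᴵ ⊥'
≺⇒⋡ d e = ⇒E (∧E₂ d) (≼-antisym (∧E₁ d) e)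

≼-≺-trans : Γ ⊢ᴵ s ≼ t → Γ ⊢ᴵ t ≺ u → Γ ⊢ᴵ s ≺ u
≼-≺-trans d e = 𝐒≼⇒≺ (≼-trans (𝐒-mono-≼ d) (≺⇒𝐒≼ e))

≺-≼-trans : Γ ⊢ᴵ s ≺ t → Γ ⊢ᴵ t ≼ u → Γ ⊢ᴵ s ≺ u
≺-≼-trans d e = 𝐒≼⇒≺ (≼-trans (≺⇒𝐒≼ d) e)

module ≼-Reasoning where
  infixr 2 _≼⟨_⟩_ _≐⟨_⟩_
  infix  3 _∎

  _≼⟨_⟩_ : ∀ s → Γ ⊢ᴵ s ≼ t → Γ ⊢ᴵ t ≼ u → Γ ⊢ᴵ s ≼ u
  s ≼⟨ d ⟩ e = ≼-trans d e

  _≐⟨_⟩_ : ∀ s → Γ ⊢ᴵ s ≐ t → Γ ⊢ᴵ t ≼ u → Γ ⊢ᴵ s ≼ u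
  s ≐⟨ d ⟩ e = ≼-respˡ-≐ (≐-sym d) e

  _∎ : ∀ s → Γ ⊢ᴵ s ≼ s
  s ∎ = ≼-refl s

+-monoˡ-≼ : ∀ u → Γ ⊢ᴵ s ≼ t → Γ ⊢ᴵ s ⊕ u ≼ t ⊕ u
+-monoˡ-≼ u d = ≼-elim d
  (≼-intro (var 0) (≐-trans (≐-sym (+-assoc (var 0) _ (shiftT u))) (cong-⊕ˡ (shiftT u) hyp)))

+-monoʳ-≼ : ∀ u → Γ ⊢ᴵ s ≼ t → Γ ⊢ᴵ u ⊕ s ≼ u ⊕ t
+-monoʳ-≼ {s = s} {t} u d = ≼-respʳ-≐ (+-comm t u) (≼-respˡ-≐ (+-comm s u) (+-monoˡ-≼ u d))

+-cancelʳ-≼ : ∀ u → Γ ⊢ᴵ s ⊕ u ≼ t ⊕ u → Γ ⊢ᴵ s ≼ t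
+-cancelʳ-≼ {s = s} {t} u d = by-cases (t ≺ s)
  (⊥E (𝐒s≼s⇒⊥ (≼-trans (≼-respˡ-≐ (suc-+ t u) (+-monoˡ-≼ u (≺⇒𝐒≼ hyp))) (wk₁ d))))
  (¬≺⇒≽ hyp)

+-cancelˡ-≼ : ∀ u → Γ ⊢ᴵ u ⊕ s ≼ u ⊕ t → Γ ⊢ᴵ s ≼ t
+-cancelˡ-≼ {s = s} {t} u d = +-cancelʳ-≼ u (≼-respʳ-≐ (+-comm u t) (≼-respˡ-≐ (+-comm u s) d))

*-monoˡ-≼ : ∀ u → Γ ⊢ᴵ s ≼ t → Γ ⊢ᴵ s ⊗ u ≼ t ⊗ u
*-monoˡ-≼ u d = ≼-elim d
  (≼-intro _ (≐-trans (≐-sym (*-distribʳ-+ (var 0) _ (shiftT u))) (cong-⊗ˡ (shiftT u) hyp)))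

*-monoʳ-≼ : ∀ u → Γ ⊢ᴵ s ≼ t → Γ ⊢ᴵ u ⊗ s ≼ u ⊗ t
*-monoʳ-≼ {s = s} {t} u d = ≼-respʳ-≐ (*-comm t u) (≼-respˡ-≐ (*-comm s u) (*-monoˡ-≼ u d))

*-mono-≼ : Γ ⊢ᴵ s ≼ t → Γ ⊢ᴵ s₁ ≼ t₁ → Γ ⊢ᴵ s ⊗ s₁ ≼ t ⊗ t₁
*-mono-≼ {t = t} {s₁ = s₁} d e = ≼-trans (*-monoˡ-≼ s₁ d) (*-monoʳ-≼ t e)

*-monoˡ-≺ : Γ ⊢ᴵ 𝟎 ≺ u → Γ ⊢ᴵ s ≺ t → Γ ⊢ᴵ s ⊗ u ≺ t ⊗ u
*-monoˡ-≺ {u = u} {s} {t} p d = 𝐒≼⇒≺ (≼-trans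
  (≼-respˡ-≐ (+-one (s ⊗ u)) (+-monoʳ-≼ (s ⊗ u) (≺⇒𝐒≼ p)))
  (≼-respˡ-≐ (suc-* s u) (*-monoˡ-≼ u (≺⇒𝐒≼ d))))

*-monoʳ-≺ : Γ ⊢ᴵ 𝟎 ≺ u → Γ ⊢ᴵ s ≺ t → Γ ⊢ᴵ u ⊗ s ≺ u ⊗ t
*-monoʳ-≺ {u = u} {s} {t} p d = ≺-resp-≐ (*-comm s u) (*-comm t u) (*-monoˡ-≺ p d)

*-cancelʳ-≼ : Γ ⊢ᴵ 𝟎 ≺ u → Γ ⊢ᴵ s ⊗ u ≼ t ⊗ u → Γ ⊢ᴵ s ≼ t
*-cancelʳ-≼ {s = s} {t} p d = by-cases (t ≺ s)
  (⊥E (≺⇒⋡ (*-monoˡ-≺ (wk₁ p) hyp) (wk₁ d)))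
  (¬≺⇒≽ hyp)

*-mono-≺ : Γ ⊢ᴵ s ≺ t → Γ ⊢ᴵ s₁ ≺ t₁ → Γ ⊢ᴵ s ⊗ s₁ ≺ t ⊗ t₁
*-mono-≺ {s = s} {s₁ = s₁} d e = ≼-≺-trans (*-monoʳ-≼ s (∧E₁ e)) (*-monoˡ-≺ (≼-≺-trans (z≼n s₁) e) d)

*-interchange : ∀ s t u w → Γ ⊢ᴵ (s ⊗ t) ⊗ (u ⊗ w) ≐ (s ⊗ u) ⊗ (t ⊗ w)
*-interchange s t u w =
  (s ⊗ t) ⊗ (u ⊗ w) ≐⟨ *-assoc s t _ ⟩
  s ⊗ (t ⊗ (u ⊗ w)) ≐⟨ cong-⊗ʳ s (≐-sym (*-assoc t u w)) ⟩
  s ⊗ ((t ⊗ u) ⊗ w) ≐⟨ cong-⊗ʳ s (cong-⊗ˡ w (*-comm t u)) ⟩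
  s ⊗ ((u ⊗ t) ⊗ w) ≐⟨ cong-⊗ʳ s (*-assoc u t w) ⟩
  s ⊗ (u ⊗ (t ⊗ w)) ≐⟨ ≐-sym (*-assoc s u _) ⟩
  (s ⊗ u) ⊗ (t ⊗ w) ∎
  where
  open ≐-Reasoning

-- Exponentiation

^-identityʳ : ∀ s → Γ ⊢ᴵ s ^' 𝟏 ≐ s
^-identityʳ s = ≐-trans (^-suc s 𝟎) (≐-trans (cong-⊗ˡ s (^-zero s)) (*-identityˡ s))

𝟏^s≐𝟏 : ∀ s → Γ ⊢ᴵ 𝟏 ^' s ≐ 𝟏
𝟏^s≐𝟏 = induction (𝟏 ^' v0 ≐ 𝟏) (qf-≐ _ _) [] refl
  (^-zero 𝟏)
  (≐-trans (^-suc 𝟏 (var 0)) (≐-trans (*-identityʳ _) hyp))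

^-distribˡ-+-* : ∀ s t u → Γ ⊢ᴵ s ^' (t ⊕ u) ≐ (s ^' t) ⊗ (s ^' u)
^-distribˡ-+-* s t = induction (v1 ^' (v2 ⊕ v0) ≐ (v1 ^' v2) ⊗ (v1 ^' v0)) (qf-≐ _ _) (s ∷ t ∷ []) refl
  (≐-trans (cong-^ʳ s (+-identityʳ t))
    (≐-trans (≐-sym (*-identityʳ _)) (cong-⊗ʳ (s ^' t) (≐-sym (^-zero s)))))
  (s′ ^' (t′ ⊕ 𝐒 v)                ≐⟨ cong-^ʳ s′ (+-suc t′ v) ⟩
   s′ ^' 𝐒 (t′ ⊕ v)                ≐⟨ ^-suc s′ _ ⟩
   (s′ ^' (t′ ⊕ v)) ⊗ s′           ≐⟨ cong-⊗ˡ s′ hyp ⟩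
   ((s′ ^' t′) ⊗ (s′ ^' v)) ⊗ s′   ≐⟨ *-assoc _ _ _ ⟩
   (s′ ^' t′) ⊗ ((s′ ^' v) ⊗ s′)   ≐⟨ cong-⊗ʳ (s′ ^' t′) (≐-sym (^-suc s′ v)) ⟩
   (s′ ^' t′) ⊗ (s′ ^' 𝐒 v)        ∎)
  where
  open ≐-Reasoning
  s′ = shiftT s
  t′ = shiftT t
  v = var 0

^-distribʳ-* : ∀ s t u → Γ ⊢ᴵ (s ⊗ t) ^' u ≐ (s ^' u) ⊗ (t ^' u)
^-distribʳ-* s t = induction ((v1 ⊗ v2) ^' v0 ≐ (v1 ^' v0) ⊗ (v2 ^' v0)) (qf-≐ _ _) (s ∷ t ∷ []) refl
  (≐-trans (^-zero _) (≐-trans (≐-sym (*-identityʳ 𝟏)) (≐-sym (cong-⊗ (^-zero s) (^-zero t)))))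
  ((s′ ⊗ t′) ^' 𝐒 v                       ≐⟨ ^-suc _ v ⟩
   ((s′ ⊗ t′) ^' v) ⊗ (s′ ⊗ t′)           ≐⟨ cong-⊗ˡ _ hyp ⟩
   ((s′ ^' v) ⊗ (t′ ^' v)) ⊗ (s′ ⊗ t′)    ≐⟨ *-interchange _ _ _ _ ⟩
   ((s′ ^' v) ⊗ s′) ⊗ ((t′ ^' v) ⊗ t′)    ≐⟨ ≐-sym (cong-⊗ (^-suc s′ v) (^-suc t′ v)) ⟩
   (s′ ^' 𝐒 v) ⊗ (t′ ^' 𝐒 v)              ∎)
  where
  open ≐-Reasoning
  s′ = shiftT s
  t′ = shiftT t
  v = var 0

^-*-assoc : ∀ s t u → Γ ⊢ᴵ (s ^' t) ^' u ≐ s ^' (t ⊗ u)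
^-*-assoc s t = induction ((v1 ^' v2) ^' v0 ≐ v1 ^' (v2 ⊗ v0)) (qf-≐ _ _) (s ∷ t ∷ []) refl
  (≐-trans (^-zero _) (≐-trans (≐-sym (^-zero s)) (cong-^ʳ s (≐-sym (*-zeroʳ t)))))
  ((s′ ^' t′) ^' 𝐒 v              ≐⟨ ^-suc _ v ⟩
   ((s′ ^' t′) ^' v) ⊗ (s′ ^' t′) ≐⟨ cong-⊗ˡ _ hyp ⟩
   (s′ ^' (t′ ⊗ v)) ⊗ (s′ ^' t′)  ≐⟨ ≐-sym (^-distribˡ-+-* s′ _ _) ⟩
   s′ ^' (t′ ⊗ v ⊕ t′)            ≐⟨ cong-^ʳ s′ (≐-sym (*-suc t′ v)) ⟩
   s′ ^' (t′ ⊗ 𝐒 v)               ∎)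
  where
  open ≐-Reasoning
  s′ = shiftT s
  t′ = shiftT t
  v = var 0

^-positive : ∀ t → Γ ⊢ᴵ 𝟏 ≼ s → Γ ⊢ᴵ 𝟏 ≼ s ^' t
^-positive {s = s} t d = induction (𝟏 ≼ v1 ^' v0) (qf-≼ _ _) (s ∷ []) refl
  (≼-reflexive (≐-sym (^-zero s)))
  (≼-respʳ-≐ (≐-sym (^-suc (shiftT s) (var 0))) (≼-respˡ-≐ (*-identityˡ 𝟏) (*-mono-≼ hyp (wk-shift d))))
  t

^-monoˡ-≼ : ∀ u → Γ ⊢ᴵ s ≼ t → Γ ⊢ᴵ s ^' u ≼ t ^' u
^-monoˡ-≼ {s = s} {t} u d = induction (v1 ^' v0 ≼ v2 ^' v0) (qf-≼ _ _) (s ∷ t ∷ []) refl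
  (≼-reflexive (≐-trans (^-zero s) (≐-sym (^-zero t))))
  (≼-respʳ-≐ (≐-sym (^-suc _ (var 0))) (≼-respˡ-≐ (≐-sym (^-suc _ (var 0))) (*-mono-≼ hyp (wk-shift d))))
  u

^-monoʳ-≼ : Γ ⊢ᴵ 𝟏 ≼ s → Γ ⊢ᴵ t ≼ u → Γ ⊢ᴵ s ^' t ≼ s ^' u
^-monoʳ-≼ {s = s} {t} p d = ≼-elim d
  (≼-respʳ-≐ (≐-sym (≐-trans (cong-^ʳ (shiftT s) (≐-sym hyp))
                             (^-distribˡ-+-* (shiftT s) (var 0) (shiftT t))))
    (≼-respˡ-≐ (*-identityˡ _) (*-monoˡ-≼ (shiftT s ^' shiftT t) (^-positive (var 0) (wk-shift p)))))

^-monoˡ-≺ : Γ ⊢ᴵ s ≺ t → ∀ u → Γ ⊢ᴵ s ^' 𝐒 u ≺ t ^' 𝐒 u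
^-monoˡ-≺ {s = s} {t} d = induction (v1 ^' 𝐒 v0 ≺ v2 ^' 𝐒 v0) (qf-≺ _ _) (s ∷ t ∷ []) refl
  (≺-resp-≐ (≐-sym (^-identityʳ s)) (≐-sym (^-identityʳ t)) d)
  (≺-resp-≐ (≐-sym (^-suc _ _)) (≐-sym (^-suc _ _)) (*-mono-≺ hyp (wk-shift d)))

^-strictMonoʳ-⇔ : ∀ s t u → Γ ⊢ᴵ (𝟏 ≺ s) ⇒ ((t ≺ u) ⇔' (s ^' t ≺ s ^' u))
^-strictMonoʳ-⇔ s t u = ⇒I (∧I (⇒I increasing) (⇒I reflecting))
  where
  increasing : (t ≺ u) ∷ (𝟏 ≺ s) ∷ _ ⊢ᴵ s ^' t ≺ s ^' u
  increasing = ≺-≼-trans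
    (≺-resp-≐ (*-identityʳ (s ^' t)) (≐-sym (^-suc s t))
       (*-monoʳ-≺ (𝐒≼⇒≺ (^-positive t (∧E₁ hyp₁))) hyp₁))
    (^-monoʳ-≼ (∧E₁ hyp₁) (≺⇒𝐒≼ hyp))
  reflecting : (s ^' t ≺ s ^' u) ∷ (𝟏 ≺ s) ∷ _ ⊢ᴵ t ≺ u
  reflecting = by-cases (t ≺ u) hyp
    (⊥E (≺⇒⋡ hyp₁ (^-monoʳ-≼ (∧E₁ hyp₂) (¬≺⇒≽ hyp))))

^-strictMonoˡ-⇔ : ∀ s t u → Γ ⊢ᴵ (𝟎 ≺ s) ⇒ ((t ≺ u) ⇔' (t ^' s ≺ u ^' s))
^-strictMonoˡ-⇔ s t u = ⇒I (∧I (⇒I increasing) (⇒I reflecting))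
  where
  increasing : (t ≺ u) ∷ (𝟎 ≺ s) ∷ _ ⊢ᴵ t ^' s ≺ u ^' s
  increasing = zero-or-suc s
    (⊥E (≺-irrefl (≺-resp-≐ (≐refl 𝟎) hyp hyp₂)))
    (≺-resp-≐ (cong-^ʳ (shiftT t) (≐-sym hyp)) (cong-^ʳ (shiftT u) (≐-sym hyp)) (^-monoˡ-≺ hyp₁ (var 0)))
  reflecting : (t ^' s ≺ u ^' s) ∷ (𝟎 ≺ s) ∷ _ ⊢ᴵ t ≺ u
  reflecting = by-cases (t ≺ u) hyp
    (⊥E (≺⇒⋡ hyp₁ (^-monoˡ-≼ s (¬≺⇒≽ hyp))))

-- Binary logarithms and integer roots

shift-∃-sub : ∀ σ φ → shift (∃' (sub (liftS σ) φ)) ≡ ∃' (sub (liftS (shiftT ∘ σ)) φ)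
shift-∃-sub σ φ =
  cong ∃' (trans (sub-sub (liftS (var ∘ suc)) (liftS σ) φ) (sub-cong (liftS-subT (var ∘ suc) σ) φ))

¬∃-shift : ∀ σ φ → Γ ⊢ᴵ shift (¬' (∃' (sub (liftS σ) φ))) → Γ ⊢ᴵ ¬' (∃' (sub (liftS (shiftT ∘ σ)) φ))
¬∃-shift {Γ} σ φ = subst (λ χ → Γ ⊢ᴵ χ ⇒ ⊥') (shift-∃-sub σ φ)

∃I-sub : ∀ σ φ t → Γ ⊢ᴵ sub (t ∙ σ) φ → Γ ⊢ᴵ ∃' (sub (liftS σ) φ)
∃I-sub σ φ t d = ∃I t (subst (_ ⊢ᴵ_) (sym (inst-liftS t σ φ)) d)

*-two : ∀ s → Γ ⊢ᴵ s ⊗ 𝟐 ≐ s ⊕ s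
*-two s = ≐-trans (*-suc s 𝟏) (cong-⊕ˡ s (*-identityʳ s))

s≺𝟐^s : ∀ s → Γ ⊢ᴵ s ≺ 𝟐 ^' s
s≺𝟐^s = induction (v0 ≺ 𝟐 ^' v0) (qf-≺ _ _) [] refl
  (𝐒≼⇒≺ (≼-reflexive (≐-sym (^-zero 𝟐))))
  (𝐒≼⇒≺ (≼-trans (𝐒-mono-≼ (≺⇒𝐒≼ hyp))
     (≼-respʳ-≐ (≐-sym (≐-trans (^-suc 𝟐 (var 0)) (*-two _)))
       (≼-respˡ-≐ (+-one _) (+-monoʳ-≼ (𝟐 ^' var 0) (^-positive (var 0) (s≼𝐒s 𝟏)))))))

Log₂-bracket : Formula
Log₂-bracket = (𝟐 ^' v0 ≼ v1) ∧' (v1 ≺ 𝟐 ^' (v0 ⊕ 𝟏))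

binary-logarithm : ∀ k → Γ ⊢ᴵ (𝟎 ≺ k) ⇒ ∃' (sub (liftS (k ∙ var)) Log₂-bracket)
binary-logarithm {Γ} k = ⇒I (raa (≺⇒⋡ (s≺𝟐^s k) (below k)))
  where
  Γ′ = ¬' (∃' (sub (liftS (k ∙ var)) Log₂-bracket)) ∷ (𝟎 ≺ k) ∷ Γ
  below : ∀ d → Γ′ ⊢ᴵ 𝟐 ^' d ≼ k
  below = induction (𝟐 ^' v0 ≼ v1) (qf-≼ _ _) (k ∷ []) refl
    (≼-respˡ-≐ (≐-sym (^-zero 𝟐)) (≺⇒𝐒≼ hyp₁))
    (by-cases (𝟐 ^' 𝐒 (var 0) ≼ shiftT k) hyp
      (⊥E (⇒E (¬∃-shift (k ∙ var) Log₂-bracket hyp₂)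
        (∃I-sub (shiftT ∘ (k ∙ var)) Log₂-bracket (var 0)
          (∧I hyp₁ (≺-resp-≐ (≐refl (shiftT k)) (cong-^ʳ 𝟐 (≐-sym (+-one (var 0)))) (¬≼⇒≻ hyp)))))))

𝟎^s≐𝟎 : Γ ⊢ᴵ 𝟎 ≺ s → Γ ⊢ᴵ 𝟎 ^' s ≐ 𝟎
𝟎^s≐𝟎 {s = s} d = zero-or-suc s
  (⊥E (≺-irrefl (≺-resp-≐ (≐refl 𝟎) hyp (wk₁ d))))
  (≐-trans (cong-^ʳ 𝟎 hyp) (≐-trans (^-suc 𝟎 (var 0)) (*-zeroʳ _)))

s≼s^t : Γ ⊢ᴵ 𝟎 ≺ t → Γ ⊢ᴵ 𝟏 ≼ s → Γ ⊢ᴵ s ≼ s ^' t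
s≼s^t {t = t} {s} d p = zero-or-suc t
  (⊥E (≺-irrefl (≺-resp-≐ (≐refl 𝟎) hyp (wk₁ d))))
  (≼-respʳ-≐ (≐-sym (≐-trans (cong-^ʳ (shiftT s) hyp) (^-suc _ (var 0))))
    (≼-respˡ-≐ (*-identityˡ _) (*-monoˡ-≼ (shiftT s) (^-positive (var 0) (wk-shift p)))))

Root-bracket : Formula
Root-bracket = (v0 ^' v1 ≼ v2) ∧' (v2 ≺ (v0 ⊕ 𝟏) ^' v1)

integer-root : ∀ c x → Γ ⊢ᴵ (𝟎 ≺ c) ⇒ ∃' (sub (liftS (c ∙ x ∙ var)) Root-bracket)
integer-root {Γ} c x = ⇒I (raa (≺⇒⋡
    (≺-≼-trans (𝐒≼⇒≺ (≼-refl (𝐒 x))) (s≼s^t hyp₁ (𝐒-mono-≼ (z≼n x))))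
    (below (𝐒 x))))
  where
  Γ′ = ¬' (∃' (sub (liftS (c ∙ x ∙ var)) Root-bracket)) ∷ (𝟎 ≺ c) ∷ Γ
  below : ∀ m → Γ′ ⊢ᴵ m ^' c ≼ x
  below = induction (v0 ^' v1 ≼ v2) (qf-≼ _ _) (c ∷ x ∷ []) refl
    (≼-respˡ-≐ (≐-sym (𝟎^s≐𝟎 hyp₁)) (z≼n x))
    (by-cases (𝐒 (var 0) ^' shiftT c ≼ shiftT x) hyp
      (⊥E (⇒E (¬∃-shift (c ∙ x ∙ var) Root-bracket hyp₂)
        (∃I-sub (shiftT ∘ (c ∙ x ∙ var)) Root-bracket (var 0)
          (∧I hyp₁ (≺-resp-≐ (≐refl (shiftT x)) (cong-^ˡ (shiftT c) (≐-sym (+-one (var 0)))) (¬≼⇒≻ hyp)))))))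

-- The inequality (b+a)^x (by)^y ≥ (by+ax)^y b^x

*-right-comm : ∀ s t u → Γ ⊢ᴵ (s ⊗ t) ⊗ u ≐ (s ⊗ u) ⊗ t
*-right-comm s t u = ≐-trans (*-assoc s t u) (≐-trans (cong-⊗ʳ s (*-comm t u)) (≐-sym (*-assoc s u t)))

bernoulli : ∀ c a y → Γ ⊢ᴵ (c ⊕ a) ^' y ⊗ c ≼ c ^' 𝐒 y ⊕ (a ⊗ y) ⊗ (c ⊕ a) ^' y
bernoulli c a = induction ((v1 ⊕ v2) ^' v0 ⊗ v1 ≼ v1 ^' 𝐒 v0 ⊕ (v2 ⊗ v0) ⊗ (v1 ⊕ v2) ^' v0) (qf-≼ _ _)
  (c ∷ a ∷ []) refl base
  (Y ⊗ c′                                       ≐⟨ cong-⊗ˡ c′ (^-suc _ v) ⟩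
   (X ⊗ (c′ ⊕ a′)) ⊗ c′                         ≐⟨ *-right-comm X _ c′ ⟩
   (X ⊗ c′) ⊗ (c′ ⊕ a′)                         ≼⟨ *-monoˡ-≼ _ hyp ⟩
   (C ⊕ (a′ ⊗ v) ⊗ X) ⊗ (c′ ⊕ a′)               ≐⟨ *-distribʳ-+ _ _ _ ⟩
   C ⊗ (c′ ⊕ a′) ⊕ ((a′ ⊗ v) ⊗ X) ⊗ (c′ ⊕ a′)   ≐⟨ cong-⊕ (*-distribˡ-+ C c′ a′) fold-Y ⟩
   (C ⊗ c′ ⊕ C ⊗ a′) ⊕ (a′ ⊗ v) ⊗ Y             ≐⟨ +-assoc _ _ _ ⟩
   C ⊗ c′ ⊕ (C ⊗ a′ ⊕ (a′ ⊗ v) ⊗ Y)             ≐⟨ cong-⊕ʳ _ (+-comm _ _) ⟩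
   C ⊗ c′ ⊕ ((a′ ⊗ v) ⊗ Y ⊕ C ⊗ a′)             ≼⟨ +-monoʳ-≼ _ (+-monoʳ-≼ _ Ca≼aY) ⟩
   C ⊗ c′ ⊕ ((a′ ⊗ v) ⊗ Y ⊕ a′ ⊗ Y)             ≐⟨ ≐-sym unfold-rhs ⟩
   c′ ^' 𝐒 (𝐒 v) ⊕ (a′ ⊗ 𝐒 v) ⊗ Y               ∎)
  where
  open ≼-Reasoning
  base : _ ⊢ᴵ (c ⊕ a) ^' 𝟎 ⊗ c ≼ c ^' 𝟏 ⊕ (a ⊗ 𝟎) ⊗ (c ⊕ a) ^' 𝟎
  base = ≼-reflexive (≐-trans (≐-trans (cong-⊗ˡ c (^-zero _)) (*-identityˡ c))
    (≐-sym (≐-trans (cong-⊕ (^-identityʳ c) (≐-trans (cong-⊗ˡ _ (*-zeroʳ a)) (*-zeroˡ _))) (+-identityʳ c))))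
  c′ = shiftT c
  a′ = shiftT a
  v = var 0
  X = (c′ ⊕ a′) ^' v
  Y = (c′ ⊕ a′) ^' 𝐒 v
  C = c′ ^' 𝐒 v
  fold-Y : _ ⊢ᴵ ((a′ ⊗ v) ⊗ X) ⊗ (c′ ⊕ a′) ≐ (a′ ⊗ v) ⊗ Y
  fold-Y = ≐-trans (*-assoc _ X _) (cong-⊗ʳ _ (≐-sym (^-suc _ v)))
  Ca≼aY : _ ⊢ᴵ C ⊗ a′ ≼ a′ ⊗ Y
  Ca≼aY = ≼-respˡ-≐ (*-comm a′ C) (*-monoʳ-≼ a′ (^-monoˡ-≼ (𝐒 v) (s≼s⊕t c′ a′)))
  unfold-rhs : _ ⊢ᴵ c′ ^' 𝐒 (𝐒 v) ⊕ (a′ ⊗ 𝐒 v) ⊗ Y ≐ C ⊗ c′ ⊕ ((a′ ⊗ v) ⊗ Y ⊕ a′ ⊗ Y)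
  unfold-rhs = cong-⊕ (^-suc c′ _) (≐-trans (cong-⊗ˡ Y (*-suc a′ v)) (*-distribʳ-+ _ _ _))

power-ratio-bound : ∀ a b y c → Γ ⊢ᴵ (a ⊕ b) ⊗ y ≼ c → Γ ⊢ᴵ 𝟎 ≺ b → Γ ⊢ᴵ 𝟎 ≺ y →
  Γ ⊢ᴵ (c ⊕ a) ^' y ⊗ b ≼ (b ⊕ a) ⊗ c ^' y
power-ratio-bound a b y c h pb py = *-cancelʳ-≼ c-positive scaled
  where
  open ≼-Reasoning
  X = (c ⊕ a) ^' y
  C = c ^' 𝐒 y
  c-positive : _ ⊢ᴵ 𝟎 ≺ c
  c-positive = 𝐒≼⇒≺ (≼-trans (≼-respˡ-≐ (*-identityˡ 𝟏) (*-mono-≼ (≺⇒𝐒≼ pb) (≺⇒𝐒≼ py)))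
                    (≼-trans (*-monoˡ-≼ y (s≼t⊕s a b)) h))
  Xby≼C : _ ⊢ᴵ X ⊗ (b ⊗ y) ≼ C
  Xby≼C = +-cancelˡ-≼ (X ⊗ (a ⊗ y))
    (X ⊗ (a ⊗ y) ⊕ X ⊗ (b ⊗ y) ≐⟨ ≐-sym (≐-trans (cong-⊗ʳ X (*-distribʳ-+ a b y)) (*-distribˡ-+ X _ _)) ⟩
     X ⊗ ((a ⊕ b) ⊗ y)         ≼⟨ *-monoʳ-≼ X h ⟩
     X ⊗ c                     ≼⟨ bernoulli c a y ⟩
     C ⊕ (a ⊗ y) ⊗ X           ≐⟨ ≐-trans (+-comm _ _) (cong-⊕ˡ C (*-comm _ X)) ⟩
     X ⊗ (a ⊗ y) ⊕ C           ∎)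
  regroup : _ ⊢ᴵ ((a ⊗ y) ⊗ X) ⊗ b ≐ a ⊗ (X ⊗ (b ⊗ y))
  regroup = ≐-trans (cong-⊗ˡ b (*-assoc a y X)) (≐-trans (*-assoc a _ b) (cong-⊗ʳ a
              (≐-trans (*-assoc y X b) (≐-trans (*-comm y _) (*-assoc X b y)))))
  scaled : _ ⊢ᴵ (X ⊗ b) ⊗ c ≼ ((b ⊕ a) ⊗ c ^' y) ⊗ c
  scaled =
    (X ⊗ b) ⊗ c               ≐⟨ *-right-comm X b c ⟩
    (X ⊗ c) ⊗ b               ≼⟨ *-monoˡ-≼ b (bernoulli c a y) ⟩
    (C ⊕ (a ⊗ y) ⊗ X) ⊗ b     ≐⟨ *-distribʳ-+ _ _ b ⟩
    C ⊗ b ⊕ ((a ⊗ y) ⊗ X) ⊗ b ≐⟨ cong-⊕ʳ _ regroup ⟩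
    C ⊗ b ⊕ a ⊗ (X ⊗ (b ⊗ y)) ≼⟨ +-monoʳ-≼ _ (*-monoʳ-≼ a Xby≼C) ⟩
    C ⊗ b ⊕ a ⊗ C             ≐⟨ ≐-trans (cong-⊕ˡ _ (*-comm C b)) (≐-sym (*-distribʳ-+ b a C)) ⟩
    (b ⊕ a) ⊗ C               ≐⟨ ≐-trans (cong-⊗ʳ _ (^-suc c y)) (≐-sym (*-assoc _ _ c)) ⟩
    ((b ⊕ a) ⊗ c ^' y) ⊗ c    ∎

-- The induction step (on w = x − y) is power-ratio-bound with c = by + a(y + w).
power-inequality-offset : ∀ a b y → Γ ⊢ᴵ 𝟎 ≺ b → Γ ⊢ᴵ 𝟎 ≺ y → ∀ w →
  Γ ⊢ᴵ (b ⊗ y ⊕ a ⊗ (y ⊕ w)) ^' y ⊗ b ^' (y ⊕ w) ≼ (b ⊕ a) ^' (y ⊕ w) ⊗ (b ⊗ y) ^' y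
power-inequality-offset a b y pb py = induction
  ((v2 ⊗ v3 ⊕ v1 ⊗ (v3 ⊕ v0)) ^' v3 ⊗ v2 ^' (v3 ⊕ v0) ≼ (v2 ⊕ v1) ^' (v3 ⊕ v0) ⊗ (v2 ⊗ v3) ^' v3) (qf-≼ _ _)
  (a ∷ b ∷ y ∷ []) refl
  (≼-reflexive (≐-trans lhs₀ (≐-sym rhs₀)))
  ((b′ ⊗ y′ ⊕ a′ ⊗ (y′ ⊕ 𝐒 v)) ^' y′ ⊗ b′ ^' (y′ ⊕ 𝐒 v)
                                 ≐⟨ cong-⊗ (cong-^ˡ y′ c-step) b-step ⟩
   (c ⊕ a′) ^' y′ ⊗ (P ⊗ b′)    ≐⟨ ≐-trans (cong-⊗ʳ _ (*-comm P b′)) (≐-sym (*-assoc _ b′ P)) ⟩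
   ((c ⊕ a′) ^' y′ ⊗ b′) ⊗ P    ≼⟨ *-monoˡ-≼ P ratio ⟩
   ((b′ ⊕ a′) ⊗ c ^' y′) ⊗ P    ≐⟨ *-assoc _ _ P ⟩
   (b′ ⊕ a′) ⊗ (c ^' y′ ⊗ P)    ≼⟨ *-monoʳ-≼ _ hyp ⟩
   (b′ ⊕ a′) ⊗ (Q ⊗ R)          ≐⟨ ≐-trans (≐-sym (*-assoc _ Q R)) (cong-⊗ˡ R (*-comm _ Q)) ⟩
   (Q ⊗ (b′ ⊕ a′)) ⊗ R          ≐⟨ cong-⊗ˡ R (≐-sym (≐-trans (cong-^ʳ _ (+-suc y′ v)) (^-suc _ _))) ⟩
   (b′ ⊕ a′) ^' (y′ ⊕ 𝐒 v) ⊗ R  ∎)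
  where
  open ≼-Reasoning
  a′ = shiftT a
  b′ = shiftT b
  y′ = shiftT y
  v = var 0
  c = b′ ⊗ y′ ⊕ a′ ⊗ (y′ ⊕ v)
  P = b′ ^' (y′ ⊕ v)
  Q = (b′ ⊕ a′) ^' (y′ ⊕ v)
  R = (b′ ⊗ y′) ^' y′
  c-step : _ ⊢ᴵ b′ ⊗ y′ ⊕ a′ ⊗ (y′ ⊕ 𝐒 v) ≐ c ⊕ a′
  c-step = ≐-trans (cong-⊕ʳ _ (≐-trans (cong-⊗ʳ a′ (+-suc y′ v)) (*-suc a′ _))) (≐-sym (+-assoc _ _ _))
  b-step : _ ⊢ᴵ b′ ^' (y′ ⊕ 𝐒 v) ≐ P ⊗ b′
  b-step = ≐-trans (cong-^ʳ b′ (+-suc y′ v)) (^-suc b′ _)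
  c-large : _ ⊢ᴵ (a′ ⊕ b′) ⊗ y′ ≼ c
  c-large = ≼-respˡ-≐ (≐-sym (≐-trans (*-distribʳ-+ a′ b′ y′) (+-comm _ _)))
              (+-monoʳ-≼ _ (*-monoʳ-≼ a′ (s≼s⊕t y′ v)))
  ratio : _ ⊢ᴵ (c ⊕ a′) ^' y′ ⊗ b′ ≼ (b′ ⊕ a′) ⊗ c ^' y′
  ratio = power-ratio-bound a′ b′ y′ c c-large (wk-shift pb) (wk-shift py)
  lhs₀ : _ ⊢ᴵ (b ⊗ y ⊕ a ⊗ (y ⊕ 𝟎)) ^' y ⊗ b ^' (y ⊕ 𝟎) ≐ ((b ⊕ a) ^' y ⊗ y ^' y) ⊗ b ^' y
  lhs₀ = cong-⊗ (≐-trans (cong-^ˡ y base-sum) (^-distribʳ-* _ _ _)) (cong-^ʳ b (+-identityʳ y))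
    where
    base-sum : _ ⊢ᴵ b ⊗ y ⊕ a ⊗ (y ⊕ 𝟎) ≐ (b ⊕ a) ⊗ y
    base-sum = ≐-trans (cong-⊕ʳ _ (cong-⊗ʳ a (+-identityʳ y))) (≐-sym (*-distribʳ-+ b a y))
  rhs₀ : _ ⊢ᴵ (b ⊕ a) ^' (y ⊕ 𝟎) ⊗ (b ⊗ y) ^' y ≐ ((b ⊕ a) ^' y ⊗ y ^' y) ⊗ b ^' y
  rhs₀ = ≐-trans (cong-⊗ (cong-^ʳ _ (+-identityʳ y)) (≐-trans (^-distribʳ-* b y y) (*-comm _ _)))
                 (≐-sym (*-assoc _ _ _))

power-inequality : ∀ a b y x → Γ ⊢ᴵ (𝟎 ≺ a) ⇒ (𝟎 ≺ b) ⇒ (𝟎 ≺ y) ⇒ (y ≼ x) ⇒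
  ((b ⊗ y ⊕ a ⊗ x) ^' y ⊗ (b ^' x) ≼ (b ⊕ a) ^' x ⊗ ((b ⊗ y) ^' y))
power-inequality a b y x = ⇒I (⇒I (⇒I (⇒I (≼-elim hyp
  (replace ((v2 ⊗ v3 ⊕ v1 ⊗ v0) ^' v3 ⊗ v2 ^' v0 ≼ (v2 ⊕ v1) ^' v0 ⊗ (v2 ⊗ v3) ^' v3)
     (shiftT a ∙ shiftT b ∙ shiftT y ∙ var) (≐-trans (+-comm (shiftT y) (var 0)) hyp)
     (power-inequality-offset (shiftT a) (shiftT b) (shiftT y) hyp₃ hyp₂ (var 0)))))))

derivable : ∀ φ → TExp φ → [] ⊢ᴵ φ
derivable _ T1  = ∀I (^-zero (var 0))
derivable _ T2  = ∀I (^-identityʳ (var 0))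
derivable _ T3  = ∀I (𝟏^s≐𝟏 (var 0))
derivable _ T4  = ∀I (∀I (∀I (^-distribˡ-+-* (var 0) (var 1) (var 2))))
derivable _ T5  = ∀I (∀I (∀I (^-distribʳ-* (var 0) (var 1) (var 2))))
derivable _ T6  = ∀I (∀I (∀I (^-*-assoc (var 0) (var 1) (var 2))))
derivable _ T7  = ∀I (∀I (∀I (^-strictMonoʳ-⇔ (var 0) (var 1) (var 2))))
derivable _ T8  = ∀I (∀I (∀I (^-strictMonoˡ-⇔ (var 0) (var 1) (var 2))))
derivable _ T9  = ∀I (binary-logarithm (var 0))
derivable _ T10 = ∀I (∀I (integer-root (var 0) (var 1)))
derivable _ T11 = ∀I (∀I (∀I (∀I (power-inequality (var 0) (var 1) (var 2) (var 3)))))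

mainTheorem8 : (φ : Formula) → TExp φ → IOpenExp ⊩ φ
mainTheorem8 φ t = ⊢ᴵ⇒⊩ (derivable φ t)
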